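{- For $n\in\omega$ let $K_{\mathrm{CPZ}}(n)$ be the (finite) set of structures in $K_{\mathrm{CPZ}}$ with domain $\{1,\dots,n\}$ and $\mu_n$ the uniform probability measure on it. Then there is a sentence $\varphi\in T_{\mathrm{CPZ}}$ such that $$\lim_{n\to\infty}\mu_n\big(\{A\in K_{\mathrm{CPZ}}(n)\mid A\models\varphi\}\big)=0.$$
   Context: Let $L$ be the language with a relation symbol $E_k(\bar x;\bar y)$ of arity $2k$ for each $k\ge1$ ($\bar x,\bar y$ being $k$-tuples). $K_{\mathrm{CPZ}}$ is the class of finite $L$-structures such that for each $k$, $E_k$ is an equivalence relation on $k$-tuples and the set of $k$-tuples that do not consist of $k$ distinct elements forms a single $E_k$-equivalence class. $K_{\mathrm{CPZ}}$ is a Fraïssé class, and $T_{\mathrm{CPZ}}$ is its generic theory (the theory of the countable ultrahomogeneous $L$-structure with age $K_{\mathrm{CPZ}}$). -}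

module Defs where

open import Data.Nat using (ℕ; zero; suc; _^_; _≟_)
open import Data.Fin using (Fin; combine) renaming (_≟_ to _≟ᶠ_)
import Data.Fin as F
open import Data.Vec using (Vec; []; _∷_; lookup; map; toList)
open import Data.List using (List; [_]; concatMap; allFin; filterᵇ; length)
open import Data.Bool.ListAction using (all; any)
import Data.List as L
open import Data.Bool using (Bool; true; false; _∧_; _∨_; not; if_then_else_)
open import Data.Unit using (⊤; tt)
open import Data.Empty using (⊥)
open import Data.Product using (Σ; _×_; _,_)
open import Data.Sum using (_⊎_)
open import Relation.Nullary using (¬_; yes; no)
open import Relation.Nullary.Decidable using (⌊_⌋)
open import Relation.Binary.PropositionalEquality using (_≡_; _≢_; refl)

_⇔_ : Set → Set → Set
A ⇔ B = (A → B) × (B → A)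

-- Syntax of first-order L-formulas, L = {E_k : k ≥ 1}, E_k of arity 2k.
-- De Bruijn variables: a Formula v has free variables among Fin v.
-- relE k xs ys  is  E_{k+1}(xs ; ys).

data Formula (v : ℕ) : Set where
  relE : (k : ℕ) → Vec (Fin v) (suc k) → Vec (Fin v) (suc k) → Formula v
  eq   : Fin v → Fin v → Formula v
  ff   : Formula v
  neg  : Formula v → Formula v
  and  : Formula v → Formula v → Formula v
  or   : Formula v → Formula v → Formula v
  imp  : Formula v → Formula v → Formula v
  all∀ : Formula (suc v) → Formula v
  ex∃  : Formula (suc v) → Formula v

Sentence : Set
Sentence = Formula 0

record Structure : Set₁ where
  field
    Carrier : Set
    -- E k X Y  is  E_{k+1}(X ; Y)
    E : (k : ℕ) → Vec Carrier (suc k) → Vec Carrier (suc k) → Set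
open Structure public

-- Classical (double-negation / Goedel-Gentzen) semantics, so that
-- satisfaction agrees with the usual classical Tarskian semantics.
Sat : (M : Structure) {v : ℕ} → Formula v → Vec (Carrier M) v → Set
Sat M (relE k xs ys) ρ = ¬ ¬ E M k (map (lookup ρ) xs) (map (lookup ρ) ys)
Sat M (eq i j)       ρ = ¬ ¬ (lookup ρ i ≡ lookup ρ j)
Sat M ff             ρ = ⊥
Sat M (neg φ)        ρ = ¬ Sat M φ ρ
Sat M (and φ ψ)      ρ = Sat M φ ρ × Sat M ψ ρ
Sat M (or φ ψ)       ρ = ¬ ¬ (Sat M φ ρ ⊎ Sat M ψ ρ)
Sat M (imp φ ψ)      ρ = Sat M φ ρ → Sat M ψ ρ
Sat M (all∀ φ)       ρ = (a : Carrier M) → Sat M φ (a ∷ ρ)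
Sat M (ex∃ φ)        ρ = ¬ ¬ Σ (Carrier M) (λ a → Sat M φ (a ∷ ρ))

-- Finite structures with domain Fin n (= {1,…,n}), encoded as finite data.
-- For k ≤ n, E_k is stored as a Boolean (n^k)×(n^k) matrix, k-tuples being
-- coded by enc.  For k > n every k-tuple is non-injective, so in a
-- K_CPZ structure E_k is forced to be the total relation; the decoding
-- relUpTo returns true there.  Hence structures in K_CPZ(n) correspond
-- bijectively to elements D of FinStr n with checkCPZ D ≡ true.

enc : ∀ {n k} → Vec (Fin n) k → Fin (n ^ k)
enc []       = F.zero
enc (x ∷ xs) = combine x (enc xs)

RelData : ℕ → ℕ → Set
RelData n k = Vec (Vec Bool (n ^ k)) (n ^ k)

relAt : ∀ {n k} → RelData n k → Vec (Fin n) k → Vec (Fin n) k → Bool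
relAt R x y = lookup (lookup R (enc x)) (enc y)

-- relations E_1, …, E_m
DataUpTo : ℕ → ℕ → Set
DataUpTo n zero    = ⊤
DataUpTo n (suc m) = DataUpTo n m × RelData n (suc m)

FinStr : ℕ → Set
FinStr n = DataUpTo n n

-- relUpTo m D k x y : the value of E_{k+1}(x ; y)
relUpTo : ∀ {n} m → DataUpTo n m → (k : ℕ) →
          Vec (Fin n) (suc k) → Vec (Fin n) (suc k) → Bool
relUpTo zero    tt      k x y = true
relUpTo (suc m) (D , R) k x y with k ≟ m
... | yes refl = relAt R x y
... | no _     = relUpTo m D k x y

finRel : ∀ {n} → FinStr n → (k : ℕ) →
         Vec (Fin n) (suc k) → Vec (Fin n) (suc k) → Bool
finRel {n} = relUpTo n

allVec : ∀ {A : Set} → List A → (k : ℕ) → List (Vec A k)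
allVec xs zero    = [ [] ]
allVec xs (suc k) = concatMap (λ x → L.map (x ∷_) (allVec xs k)) xs

bools : List Bool
bools = true L.∷ false L.∷ L.[]

allRel : (n k : ℕ) → List (RelData n k)
allRel n k = allVec (allVec bools (n ^ k)) (n ^ k)

allData : (n m : ℕ) → List (DataUpTo n m)
allData n zero    = [ tt ]
allData n (suc m) = concatMap (λ D → L.map (D ,_) (allRel n (suc m))) (allData n m)

tuples : (n k : ℕ) → List (Vec (Fin n) k)
tuples n k = allVec (allFin n) k

distinctL : ∀ {n} → List (Fin n) → Bool
distinctL L.[]       = true
distinctL (x L.∷ xs) = not (any (λ y → ⌊ x ≟ᶠ y ⌋) xs) ∧ distinctL xs

injB : ∀ {n k} → Vec (Fin n) k → Bool
injB x = distinctL (toList x)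

_⇒ᵇ_ : Bool → Bool → Bool
a ⇒ᵇ b = not a ∨ b

_==ᵇ_ : Bool → Bool → Bool
a ==ᵇ b = if a then b else not b

-- E is an equivalence relation on k-tuples and the non-injective k-tuples
-- are all E-equivalent and E-inequivalent to every injective tuple
-- (i.e. they form a single class whenever there are any).
cpzRelB : (n k : ℕ) → (Vec (Fin n) k → Vec (Fin n) k → Bool) → Bool
cpzRelB n k r =
  all (λ x → r x x) ts ∧
  all (λ x → all (λ y → r x y ⇒ᵇ r y x) ts) ts ∧
  all (λ x → all (λ y → all (λ z → (r x y ∧ r y z) ⇒ᵇ r x z) ts) ts) ts ∧
  all (λ x → all (λ y → not (injB x) ⇒ᵇ (r x y ==ᵇ not (injB y))) ts) ts
  where ts = tuples n k

checkUpTo : ∀ {n} m → DataUpTo n m → Bool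
checkUpTo         zero    tt      = true
checkUpTo {n} (suc m) (D , R) = checkUpTo m D ∧ cpzRelB n (suc m) (relAt R)

checkCPZ : ∀ {n} → FinStr n → Bool
checkCPZ {n} = checkUpTo n

evalB : ∀ {n v} → FinStr n → Formula v → Vec (Fin n) v → Bool
evalB A (relE k xs ys) ρ = finRel A k (map (lookup ρ) xs) (map (lookup ρ) ys)
evalB A (eq i j)       ρ = ⌊ lookup ρ i ≟ᶠ lookup ρ j ⌋
evalB A ff             ρ = false
evalB A (neg φ)        ρ = not (evalB A φ ρ)
evalB A (and φ ψ)      ρ = evalB A φ ρ ∧ evalB A ψ ρ
evalB A (or φ ψ)       ρ = evalB A φ ρ ∨ evalB A ψ ρ
evalB A (imp φ ψ)      ρ = evalB A φ ρ ⇒ᵇ evalB A ψ ρ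
evalB {n} A (all∀ φ)   ρ = all (λ a → evalB A φ (a ∷ ρ)) (allFin n)
evalB {n} A (ex∃ φ)    ρ = any (λ a → evalB A φ (a ∷ ρ)) (allFin n)

countK : ℕ → ℕ
countK n = length (filterᵇ (λ A → checkCPZ A) (allData n n))

countSat : Sentence → ℕ → ℕ
countSat φ n = length (filterᵇ (λ A → checkCPZ A ∧ evalB A φ []) (allData n n))

NonInj : ∀ {A : Set} {k} → Vec A k → Set
NonInj {k = k} X = Σ (Fin k) λ i → Σ (Fin k) λ j → (i ≢ j) × (lookup X i ≡ lookup X j)

Countable : Structure → Set
Countable M = Σ (Carrier M → ℕ) λ f → ∀ x y → f x ≡ f y → x ≡ y

SubInK : (M : Structure) {m : ℕ} → Vec (Carrier M) m → Set
SubInK M {m} a = ∀ k (x y z : Vec (Fin m) (suc k)) →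
  let X = map (lookup a) x ; Y = map (lookup a) y ; Z = map (lookup a) z in
  E M k X X ×
  (E M k X Y → E M k Y X) ×
  (E M k X Y → E M k Y Z → E M k X Z) ×
  (NonInj X → (E M k X Y ⇔ NonInj Y))

AgeInK : Structure → Set
AgeInK M = ∀ m (a : Vec (Carrier M) m) → SubInK M a

Embeds : ∀ {n} → FinStr n → Structure → Set
Embeds {n} A M = Σ (Fin n → Carrier M) λ f →
  (∀ i j → f i ≡ f j → i ≡ j) ×
  (∀ k (x y : Vec (Fin n) (suc k)) → (finRel A k x y ≡ true) ⇔ E M k (map f x) (map f y))

KInAge : Structure → Set
KInAge M = ∀ n (A : FinStr n) → checkCPZ A ≡ true → Embeds A M

PartialIso : (M : Structure) {m : ℕ} → Vec (Carrier M) m → Vec (Carrier M) m → Set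
PartialIso M {m} a b =
  (∀ i j → (lookup a i ≡ lookup a j) ⇔ (lookup b i ≡ lookup b j)) ×
  (∀ k (x y : Vec (Fin m) (suc k)) →
     E M k (map (lookup a) x) (map (lookup a) y) ⇔ E M k (map (lookup b) x) (map (lookup b) y))

Automorphism : (M : Structure) → (Carrier M → Carrier M) → Set
Automorphism M σ = Σ (Carrier M → Carrier M) λ τ →
  (∀ x → τ (σ x) ≡ x) × (∀ x → σ (τ x) ≡ x) ×
  (∀ k (X Y : Vec (Carrier M) (suc k)) → E M k X Y ⇔ E M k (map σ X) (map σ Y))

Ultrahomogeneous : Structure → Set
Ultrahomogeneous M = ∀ m (a b : Vec (Carrier M) m) → PartialIso M a b →
  Σ (Carrier M → Carrier M) λ σ → Automorphism M σ × (∀ i → σ (lookup a i) ≡ lookup b i)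

-- φ ∈ T_CPZ : φ holds in the countable ultrahomogeneous structure with age K_CPZ
-- (unique up to isomorphism, so: in every such structure).
InTCPZ : Sentence → Set₁
InTCPZ φ = (M : Structure) → Countable M → Ultrahomogeneous M →
           AgeInK M → KInAge M → Sat M φ []

-- The generic structure realises φ: a pair of distinct points has one of four types, fixed by
-- whether E₁(x;y) and E₂(xy;yx) hold (decided under the double negation of the classical
-- semantics); a six-point structure of K_CPZ realising that type with four points w such that
-- E₂(01;0w) embeds, and ultrahomogeneity moves its first two points onto x and y.
--
-- A finite model D of φ with domain {0,…,n-1} has four witnesses a < b < c < d for (0,1).
-- For each i ≤ m < n - 2, changing only E₂ (the witnesses' pairs (0,w) take the classes of
-- (1,0), (a,b), (c,d), (i+2,0), which become one new class) yields another structure of K_CPZ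
-- from which i and D can be read off.  The recoded structures are never the one in which every
-- injective pair is alone in its E₂-class, so (m+1)·#{D ⊨ φ} < #K_CPZ(n).

module Submission where

open import Defs

open import Data.Bool using (Bool; true; false; T; _∧_; _∨_; not; if_then_else_)
open import Data.Bool.ListAction using (all; any)
open import Data.Bool.Properties using (∧-conicalˡ; ∧-conicalʳ; ∨-conicalˡ; ∨-conicalʳ; not-injective; T-≡; T?; ⇔→≡)
open import Data.Empty using (⊥-elim)
open import Data.Fin as F using (Fin; combine; remQuot) renaming (_≟_ to _≟ᶠ_)
import Data.Fin.Properties as F
open import Data.List as L using (List; allFin; filterᵇ; length; concatMap; cartesianProduct; cartesianProductWith)
open import Data.List.Membership.Propositional using (_∈_; find)
open import Data.List.Membership.Propositional.Properties
import Data.List.Properties as L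
open import Data.List.Relation.Unary.All as All using (All)
import Data.List.Relation.Unary.All.Properties as All
open import Data.List.Relation.Unary.AllPairs as AllPairs using (AllPairs)
import Data.List.Relation.Unary.AllPairs.Properties as AllPairsP
open import Data.List.Relation.Unary.Any using (here; there)
import Data.List.Relation.Unary.Any.Properties as Any
open import Data.List.Relation.Unary.Unique.Propositional using (Unique)
import Data.List.Relation.Unary.Unique.Propositional.Properties as Unique
open import Data.Nat as ℕ using (ℕ; zero; suc; _+_; _*_; _^_; _≤_; _<_; z≤n; s≤s)
import Data.Nat.Properties as ℕ
open import Data.Product using (Σ; _×_; _,_; proj₁; proj₂)
open import Data.Product.Properties using (,-injective)
open import Data.Sum using (_⊎_; inj₁; inj₂)
open import Data.Unit using (tt)
open import Data.Vec as V using (Vec; []; _∷_; lookup; tabulate)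
import Data.Vec.Properties as V
open import Function using (_∘_; Equivalence; mk⇔)
open import Relation.Binary.PropositionalEquality
  using (_≡_; _≢_; refl; sym; trans; cong; cong₂; subst; subst₂; ≢-sym; module ≡-Reasoning)
open import Relation.Nullary using (¬_; yes; no; Dec; contradiction)
open import Relation.Nullary.Decidable using (⌊_⌋; ¬¬-excluded-middle)

∧-intro : ∀ {a b} → a ≡ true → b ≡ true → a ∧ b ≡ true
∧-intro refl refl = refl

∨-introˡ : ∀ {a b} → a ≡ true → a ∨ b ≡ true
∨-introˡ refl = refl

∨-introʳ : ∀ {a b} → b ≡ true → a ∨ b ≡ true
∨-introʳ {true}  _ = refl
∨-introʳ {false} p = p

∨-elim : ∀ {a b} → a ∨ b ≡ true → a ≡ true ⊎ b ≡ true
∨-elim {true}  _ = inj₁ refl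
∨-elim {false} p = inj₂ p

⇒ᵇ-elim : ∀ {a b} → (a ⇒ᵇ b) ≡ true → a ≡ true → b ≡ true
⇒ᵇ-elim p refl = p

⇒ᵇ-intro : ∀ {a b} → (a ≡ true → b ≡ true) → (a ⇒ᵇ b) ≡ true
⇒ᵇ-intro {true}  f = f refl
⇒ᵇ-intro {false} f = refl

==ᵇ-elim : ∀ {a b} → (a ==ᵇ b) ≡ true → a ≡ b
==ᵇ-elim {true}  {true}  _ = refl
==ᵇ-elim {false} {false} _ = refl

==ᵇ-intro : ∀ {a b} → a ≡ b → (a ==ᵇ b) ≡ true
==ᵇ-intro {true}  refl = refl
==ᵇ-intro {false} refl = refl

isYes-true : ∀ {P : Set} (d : Dec P) → P → ⌊ d ⌋ ≡ true
isYes-true (yes _) _ = refl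
isYes-true (no ¬p) p = ⊥-elim (¬p p)

isYes-false : ∀ {P : Set} (d : Dec P) → ¬ P → ⌊ d ⌋ ≡ false
isYes-false (yes p) ¬p = ⊥-elim (¬p p)
isYes-false (no _)  _  = refl

isYes-true⁻ : ∀ {P : Set} (d : Dec P) → ⌊ d ⌋ ≡ true → P
isYes-true⁻ (yes p) _ = p

isYes-false⁻ : ∀ {P : Set} (d : Dec P) → ⌊ d ⌋ ≡ false → ¬ P
isYes-false⁻ (no ¬p) _ = ¬p

T⇒≡true : ∀ {b} → T b → b ≡ true
T⇒≡true = Equivalence.to T-≡

≡true⇒T : ∀ {b} → b ≡ true → T b
≡true⇒T = Equivalence.from T-≡

module _ {A : Set} (p : A → Bool) where

  all-true⁻ : ∀ {xs x} → all p xs ≡ true → x ∈ xs → p x ≡ true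
  all-true⁻ {xs} h x∈xs = T⇒≡true (All.lookup (All.all⁺ p xs (≡true⇒T h)) x∈xs)

  all-true⁺ : ∀ xs → (∀ {x} → x ∈ xs → p x ≡ true) → all p xs ≡ true
  all-true⁺ xs h = T⇒≡true (All.all⁻ p (All.tabulate (≡true⇒T ∘ h)))

  any-true⁻ : ∀ xs → any p xs ≡ true → Σ A λ x → x ∈ xs × p x ≡ true
  any-true⁻ xs h with find (Any.any⁻ p xs (≡true⇒T h))
  ... | x , x∈xs , px = x , x∈xs , T⇒≡true px

concatMap-map≡cartesianProductWith : ∀ {A B C : Set} (f : A → B → C) xs ys →
  concatMap (λ x → L.map (f x) ys) xs ≡ cartesianProductWith f xs ys
concatMap-map≡cartesianProductWith f L.[]       ys = refl
concatMap-map≡cartesianProductWith f (x L.∷ xs) ys =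
  cong (L.map (f x) ys L.++_) (concatMap-map≡cartesianProductWith f xs ys)

module _ {A : Set} {xs : List A} where

  ∈-allVec : (∀ a → a ∈ xs) → ∀ {k} (v : Vec A k) → v ∈ allVec xs k
  ∈-allVec _   []           = here refl
  ∈-allVec all∈ {suc k} (a ∷ v) =
    subst (_ ∈_) (sym (concatMap-map≡cartesianProductWith _∷_ xs (allVec xs k)))
      (∈-cartesianProductWith⁺ _∷_ (all∈ a) (∈-allVec all∈ v))

  allVec-unique : Unique xs → ∀ k → Unique (allVec xs k)
  allVec-unique _ zero    = All.[] AllPairs.∷ AllPairs.[]
  allVec-unique u (suc k) =
    subst Unique (sym (concatMap-map≡cartesianProductWith _∷_ xs (allVec xs k)))
      (Unique.cartesianProductWith⁺ _∷_ V.∷-injective u (allVec-unique u k))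

∈-tuples : ∀ {n k} (v : Vec (Fin n) k) → v ∈ tuples n k
∈-tuples = ∈-allVec ∈-allFin

∈-bools : ∀ b → b ∈ bools
∈-bools true  = here refl
∈-bools false = there (here refl)

bools-unique : Unique bools
bools-unique = ((λ ()) All.∷ All.[]) AllPairs.∷ (All.[] AllPairs.∷ AllPairs.[])

∈-allData : ∀ n m (D : DataUpTo n m) → D ∈ allData n m
∈-allData n zero    tt      = here refl
∈-allData n (suc m) (D , R) =
  subst (_ ∈_) (sym (concatMap-map≡cartesianProductWith _,_ (allData n m) (allRel n (suc m))))
    (∈-cartesianProductWith⁺ _,_ (∈-allData n m D) (∈-allVec (∈-allVec ∈-bools) R))

allData-unique : ∀ n m → Unique (allData n m)
allData-unique n zero    = All.[] AllPairs.∷ AllPairs.[]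
allData-unique n (suc m) =
  subst Unique (sym (concatMap-map≡cartesianProductWith _,_ (allData n m) (allRel n (suc m))))
    (Unique.cartesianProductWith⁺ _,_ ,-injective (allData-unique n m)
      (allVec-unique (allVec-unique bools-unique (n ^ suc m)) (n ^ suc m)))

length-cartesianProduct : ∀ {A B : Set} (xs : List A) (ys : List B) →
  length (cartesianProduct xs ys) ≡ length xs * length ys
length-cartesianProduct L.[]       ys = refl
length-cartesianProduct (x L.∷ xs) ys = begin
  length (L.map (x ,_) ys L.++ cartesianProduct xs ys)  ≡⟨ L.length-++ (L.map (x ,_) ys) ⟩
  length (L.map (x ,_) ys) + length (cartesianProduct xs ys)
    ≡⟨ cong₂ _+_ (L.length-map (x ,_) ys) (length-cartesianProduct xs ys) ⟩
  length ys + length xs * length ys                     ∎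
  where open ≡-Reasoning

∈-++-remove : ∀ {A : Set} {w z : A} ys zs → w ∈ ys L.++ (z L.∷ zs) → w ≢ z → w ∈ ys L.++ zs
∈-++-remove ys zs w∈ w≢z with ∈-++⁻ ys w∈
... | inj₁ w∈ys         = ∈-++⁺ˡ w∈ys
... | inj₂ (here w≡z)   = ⊥-elim (w≢z w≡z)
... | inj₂ (there w∈zs) = ∈-++⁺ʳ ys w∈zs

unique-⊆⇒length-≤ : ∀ {A : Set} (xs ys : List A) → Unique xs → (∀ {x} → x ∈ xs → x ∈ ys) →
  length xs ≤ length ys
unique-⊆⇒length-≤ L.[]       ys _ _ = z≤n
unique-⊆⇒length-≤ (x L.∷ xs) ys (x∉xs AllPairs.∷ xs!) xs⊆ys with ∈-∃++ (xs⊆ys (here refl))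
... | ys₁ , ys₂ , refl = begin
  suc (length xs)              ≤⟨ s≤s (unique-⊆⇒length-≤ xs (ys₁ L.++ ys₂) xs! xs⊆ys₁ys₂) ⟩
  suc (length (ys₁ L.++ ys₂))  ≡⟨ cong suc (L.length-++ ys₁) ⟩
  suc (length ys₁ + length ys₂) ≡⟨ ℕ.+-suc (length ys₁) (length ys₂) ⟨
  length ys₁ + suc (length ys₂) ≡⟨ L.length-++ ys₁ ⟨
  length (ys₁ L.++ x L.∷ ys₂)  ∎
  where
  open ℕ.≤-Reasoning
  xs⊆ys₁ys₂ : ∀ {w} → w ∈ xs → w ∈ ys₁ L.++ ys₂
  xs⊆ys₁ys₂ w∈xs = ∈-++-remove ys₁ ys₂ (xs⊆ys (there w∈xs)) (λ w≡x → All.lookup x∉xs w∈xs (sym w≡x))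

map-unique-injectiveOn : ∀ {A B : Set} (g : A → B) (xs : List A) → Unique xs →
  (∀ {x x'} → x ∈ xs → x' ∈ xs → g x ≡ g x' → x ≡ x') → Unique (L.map g xs)
map-unique-injectiveOn g L.[]       _                    _   = AllPairs.[]
map-unique-injectiveOn g (x L.∷ xs) (x∉xs AllPairs.∷ xs!) inj =
  All.tabulate gx∉gxs AllPairs.∷ map-unique-injectiveOn g xs xs! (λ m m' → inj (there m) (there m'))
  where
  gx∉gxs : ∀ {y} → y ∈ L.map g xs → g x ≢ y
  gx∉gxs y∈ gx≡y with ∈-map⁻ g y∈
  ... | x' , x'∈xs , y≡gx' = All.lookup x∉xs x'∈xs (inj (here refl) (there x'∈xs) (trans gx≡y y≡gx'))

injection-missing⇒length-< : ∀ {A B : Set} (xs : List A) (ys : List B) (g : A → B) → Unique xs →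
  (∀ {x} → x ∈ xs → g x ∈ ys) → (∀ {x x'} → x ∈ xs → x' ∈ xs → g x ≡ g x' → x ≡ x') →
  (y₀ : B) → y₀ ∈ ys → (∀ {x} → x ∈ xs → g x ≢ y₀) → length xs < length ys
injection-missing⇒length-< xs ys g xs! g∈ inj y₀ y₀∈ys g≢y₀ =
  subst (_≤ length ys) (cong suc (L.length-map g xs))
    (unique-⊆⇒length-≤ (y₀ L.∷ L.map g xs) ys
      (All.tabulate y₀∉ AllPairs.∷ map-unique-injectiveOn g xs xs! inj) ⊆ys)
  where
  y₀∉ : ∀ {y} → y ∈ L.map g xs → y₀ ≢ y
  y₀∉ y∈ y₀≡y with ∈-map⁻ g y∈
  ... | x , x∈xs , y≡gx = g≢y₀ x∈xs (sym (trans y₀≡y y≡gx))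
  ⊆ys : ∀ {y} → y ∈ y₀ L.∷ L.map g xs → y ∈ ys
  ⊆ys (here refl) = y₀∈ys
  ⊆ys (there y∈) with ∈-map⁻ g y∈
  ... | x , x∈xs , refl = g∈ x∈xs

Tuple : ℕ → ℕ → Set
Tuple n k = Vec (Fin n) k

BRel : ℕ → ℕ → Set
BRel n k = Tuple n k → Tuple n k → Bool

_==_ : ∀ {n k} → Tuple n k → Tuple n k → Bool
x == y = ⌊ V.≡-dec _≟ᶠ_ x y ⌋

==-refl : ∀ {n k} (x : Tuple n k) → (x == x) ≡ true
==-refl x = isYes-true (V.≡-dec _≟ᶠ_ x x) refl

==⇒≡ : ∀ {n k} {x y : Tuple n k} → (x == y) ≡ true → x ≡ y
==⇒≡ {x = x} {y} = isYes-true⁻ (V.≡-dec _≟ᶠ_ x y)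

≢⇒==-false : ∀ {n k} {x y : Tuple n k} → x ≢ y → (x == y) ≡ false
≢⇒==-false {x = x} {y} = isYes-false (V.≡-dec _≟ᶠ_ x y)

enc⁻¹ : ∀ {n} k → Fin (n ^ k) → Tuple n k
enc⁻¹     zero    _ = []
enc⁻¹ {n} (suc k) i = proj₁ (remQuot {n} (n ^ k) i) ∷ enc⁻¹ k (proj₂ (remQuot {n} (n ^ k) i))

enc⁻¹-enc : ∀ {n k} (x : Tuple n k) → enc⁻¹ k (enc x) ≡ x
enc⁻¹-enc [] = refl
enc⁻¹-enc {n} {suc k} (a ∷ x) =
  cong₂ _∷_ (cong proj₁ remQuot-combine) (trans (cong (enc⁻¹ {n} k ∘ proj₂) remQuot-combine) (enc⁻¹-enc x))
  where remQuot-combine = F.remQuot-combine {k = n ^ k} a (enc x)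

enc-enc⁻¹ : ∀ {n} k (i : Fin (n ^ k)) → enc (enc⁻¹ {n} k i) ≡ i
enc-enc⁻¹     zero    F.zero = refl
enc-enc⁻¹ {n} (suc k) i      =
  trans (cong (combine {n} (proj₁ (remQuot {n} (n ^ k) i))) (enc-enc⁻¹ {n} k _)) (F.combine-remQuot {n} (n ^ k) i)

tabulateRel : ∀ {n k} → BRel n k → RelData n k
tabulateRel {k = k} r = tabulate λ i → tabulate λ j → r (enc⁻¹ k i) (enc⁻¹ k j)

relAt-tabulateRel : ∀ {n k} (r : BRel n k) x y → relAt (tabulateRel r) x y ≡ r x y
relAt-tabulateRel r x y =
  trans (cong (λ row → lookup row (enc y)) (V.lookup∘tabulate _ (enc x)))
    (trans (V.lookup∘tabulate _ (enc y)) (cong₂ r (enc⁻¹-enc x) (enc⁻¹-enc y)))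

relAt-ext : ∀ {n k} (R R' : RelData n k) → (∀ x y → relAt R x y ≡ relAt R' x y) → R ≡ R'
relAt-ext {k = k} R R' R≗R' =
  trans (sym (V.tabulate∘lookup R)) (trans (V.tabulate-cong row) (V.tabulate∘lookup R'))
  where
  entry : ∀ i j → lookup (lookup R i) j ≡ lookup (lookup R' i) j
  entry i j = subst₂ (λ i′ j′ → lookup (lookup R i′) j′ ≡ lookup (lookup R' i′) j′)
    (enc-enc⁻¹ k i) (enc-enc⁻¹ k j) (R≗R' (enc⁻¹ k i) (enc⁻¹ k j))
  row : ∀ i → lookup R i ≡ lookup R' i
  row i = trans (sym (V.tabulate∘lookup _)) (trans (V.tabulate-cong (entry i)) (V.tabulate∘lookup _))

record IsEquivalenceᵇ {n k} (r : BRel n k) : Set where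
  field
    reflexive  : ∀ x → r x x ≡ true
    symmetric  : ∀ x y → r x y ≡ true → r y x ≡ true
    transitive : ∀ x y z → r x y ≡ true → r y z ≡ true → r x z ≡ true

  symmetric-≡ : ∀ x y → r x y ≡ r y x
  symmetric-≡ x y = ⇔→≡ (mk⇔ (symmetric x y) (symmetric y x))

  respˡ : ∀ x x' y → r x x' ≡ true → r x y ≡ r x' y
  respˡ x x' y rxx' = ⇔→≡ (mk⇔ (transitive x' x y (symmetric x x' rxx')) (transitive x x' y rxx'))

record IsCPZ {n k} (r : BRel n k) : Set where
  field
    isEquivalenceᵇ : IsEquivalenceᵇ r
    nonInj : ∀ x y → injB x ≡ false → r x y ≡ not (injB y)
  open IsEquivalenceᵇ isEquivalenceᵇ public

cpzRelB-sound : ∀ n k (r : BRel n k) → cpzRelB n k r ≡ true → IsCPZ r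
cpzRelB-sound n k r h = record
  { isEquivalenceᵇ = record
    { reflexive  = λ x → all-true⁻ _ refls (∈-tuples x)
    ; symmetric  = λ x y → ⇒ᵇ-elim (all-true⁻ _ (all-true⁻ _ syms (∈-tuples x)) (∈-tuples y))
    ; transitive = λ x y z rxy ryz → ⇒ᵇ-elim
        (all-true⁻ _ (all-true⁻ _ (all-true⁻ _ transes (∈-tuples x)) (∈-tuples y)) (∈-tuples z))
        (∧-intro rxy ryz)
    }
  ; nonInj = λ x y x-nonInj → ==ᵇ-elim (⇒ᵇ-elim
      (all-true⁻ _ (all-true⁻ _ nonInjs (∈-tuples x)) (∈-tuples y)) (cong not x-nonInj))
  }
  where
  ts : List (Tuple n k)
  ts = tuples n k
  reflB  = all (λ x → r x x) ts
  symB   = all (λ x → all (λ y → r x y ⇒ᵇ r y x) ts) ts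
  transB = all (λ x → all (λ y → all (λ z → (r x y ∧ r y z) ⇒ᵇ r x z) ts) ts) ts
  refls   = ∧-conicalˡ reflB _ h
  rest₁   = ∧-conicalʳ reflB _ h
  syms    = ∧-conicalˡ symB _ rest₁
  rest₂   = ∧-conicalʳ symB _ rest₁
  transes = ∧-conicalˡ transB _ rest₂
  nonInjs = ∧-conicalʳ transB _ rest₂

cpzRelB-complete : ∀ n k (r : BRel n k) → IsCPZ r → cpzRelB n k r ≡ true
cpzRelB-complete n k r C =
  ∧-intro (every λ x → C.reflexive x)
  (∧-intro (every λ x → every λ y → ⇒ᵇ-intro (C.symmetric x y))
  (∧-intro (every λ x → every λ y → every λ z →
              ⇒ᵇ-intro λ rxyz → C.transitive x y z (∧-conicalˡ _ _ rxyz) (∧-conicalʳ (r x y) _ rxyz))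
           (every λ x → every λ y → ⇒ᵇ-intro λ x-nonInj → ==ᵇ-intro (C.nonInj x y (not-injective x-nonInj)))))
  where
  module C = IsCPZ C
  every : ∀ {p : Tuple n k → Bool} → (∀ x → p x ≡ true) → all p (tuples n k) ≡ true
  every h = all-true⁺ _ (tuples n k) λ {x} _ → h x

IsCPZ-resp : ∀ {n k} {r r' : BRel n k} → (∀ x y → r x y ≡ r' x y) → IsCPZ r → IsCPZ r'
IsCPZ-resp {r = r} {r'} r≗r' C = record
  { isEquivalenceᵇ = record
    { reflexive  = λ x → trans (sym (r≗r' x x)) (C.reflexive x)
    ; symmetric  = λ x y p → trans (sym (r≗r' y x)) (C.symmetric x y (trans (r≗r' x y) p))
    ; transitive = λ x y z p q →
        trans (sym (r≗r' x z)) (C.transitive x y z (trans (r≗r' x y) p) (trans (r≗r' y z) q))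
    }
  ; nonInj = λ x y i → trans (sym (r≗r' x y)) (C.nonInj x y i)
  }
  where module C = IsCPZ C

==-isEquivalenceᵇ : ∀ {n k} → IsEquivalenceᵇ (_==_ {n} {k})
==-isEquivalenceᵇ = record
  { reflexive  = ==-refl
  ; symmetric  = λ x y x==y → subst (λ z → (z == x) ≡ true) (==⇒≡ x==y) (==-refl x)
  ; transitive = λ x y z x==y y==z → subst (λ w → (x == w) ≡ true) (==⇒≡ y==z) x==y
  }

collapse : ∀ {n k} → (Tuple n k → Bool) → BRel n k
collapse P x y = (x == y) ∨ (P x ∧ P y)

collapse-isEquivalenceᵇ : ∀ {n k} (P : Tuple n k → Bool) → IsEquivalenceᵇ (collapse P)
collapse-isEquivalenceᵇ P = record
  { reflexive = λ x → ∨-introˡ (==-refl x) ; symmetric = symmetric ; transitive = transitive }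
  where
  symmetric : ∀ x y → collapse P x y ≡ true → collapse P y x ≡ true
  symmetric x y h with ∨-elim {x == y} h
  ... | inj₁ x==y rewrite ==⇒≡ x==y = ∨-introˡ (==-refl y)
  ... | inj₂ PxPy = ∨-introʳ {y == x} (∧-intro (∧-conicalʳ (P x) _ PxPy) (∧-conicalˡ _ _ PxPy))
  transitive : ∀ x y z → collapse P x y ≡ true → collapse P y z ≡ true → collapse P x z ≡ true
  transitive x y z h₁ h₂ with ∨-elim {x == y} h₁ | ∨-elim {y == z} h₂
  ... | inj₁ x==y | _         rewrite ==⇒≡ x==y = h₂
  ... | inj₂ _    | inj₁ y==z rewrite ==⇒≡ y==z = h₁
  ... | inj₂ PxPy | inj₂ PyPz = ∨-introʳ {x == z} (∧-intro (∧-conicalˡ _ _ PxPy) (∧-conicalʳ (P y) _ PyPz))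

IsEquivalenceᵇ-∘ : ∀ {n k} {r : BRel n k} (f : Tuple n k → Tuple n k) →
  IsEquivalenceᵇ r → IsEquivalenceᵇ (λ x y → r (f x) (f y))
IsEquivalenceᵇ-∘ f E = record
  { reflexive  = λ x → E.reflexive (f x)
  ; symmetric  = λ x y → E.symmetric (f x) (f y)
  ; transitive = λ x y z → E.transitive (f x) (f y) (f z)
  }
  where module E = IsEquivalenceᵇ E

adjoinClass : ∀ {n k} → (Tuple n k → Bool) → BRel n k → BRel n k
adjoinClass P s x y = if P x then P y else not (P y) ∧ s x y

adjoinClass-isEquivalenceᵇ : ∀ {n k} (P : Tuple n k → Bool) {s : BRel n k} →
  IsEquivalenceᵇ s → IsEquivalenceᵇ (adjoinClass P s)
adjoinClass-isEquivalenceᵇ P {s} E = record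
  { reflexive = reflexive ; symmetric = symmetric ; transitive = transitive }
  where
  module E = IsEquivalenceᵇ E
  reflexive : ∀ x → adjoinClass P s x x ≡ true
  reflexive x with P x
  ... | true  = refl
  ... | false = E.reflexive x
  symmetric : ∀ x y → adjoinClass P s x y ≡ true → adjoinClass P s y x ≡ true
  symmetric x y h with P x | P y
  ... | true  | true  = refl
  ... | false | false = E.symmetric x y h
  transitive : ∀ x y z → adjoinClass P s x y ≡ true → adjoinClass P s y z ≡ true → adjoinClass P s x z ≡ true
  transitive x y z h₁ h₂ with P x | P y | P z
  ... | true  | true  | true  = refl
  ... | false | false | false = E.transitive x y z h₁ h₂

adjoinNonInj : ∀ {n k} → BRel n k → BRel n k
adjoinNonInj = adjoinClass (not ∘ injB)

adjoinNonInj-isCPZ : ∀ {n k} {s : BRel n k} → IsEquivalenceᵇ s → IsCPZ (adjoinNonInj s)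
adjoinNonInj-isCPZ {s = s} E = record
  { isEquivalenceᵇ = adjoinClass-isEquivalenceᵇ (not ∘ injB) E ; nonInj = nonInj }
  where
  nonInj : ∀ x y → injB x ≡ false → adjoinNonInj s x y ≡ not (injB y)
  nonInj x y x-nonInj rewrite x-nonInj = refl

adjoinNonInj-injective : ∀ {n k} {s : BRel n k} x y → injB x ≡ true → injB y ≡ true → adjoinNonInj s x y ≡ s x y
adjoinNonInj-injective _ _ x-inj y-inj rewrite x-inj | y-inj = refl

IsCPZ⇒adjoinNonInj-≡ : ∀ {n k} {r : BRel n k} → IsCPZ r → ∀ x y → adjoinNonInj r x y ≡ r x y
IsCPZ⇒adjoinNonInj-≡ {r = r} C x y with injB x in x-inj | injB y in y-inj
... | false | _     = sym (trans (IsCPZ.nonInj C x y x-inj) (cong not y-inj))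
... | true  | true  = refl
... | true  | false = sym (trans (IsCPZ.symmetric-≡ C x y) (trans (IsCPZ.nonInj C y x y-inj) (cong not x-inj)))

RelFamily : ℕ → Set
RelFamily n = (k : ℕ) → BRel n (suc k)

build : ∀ {n} m → RelFamily n → DataUpTo n m
build zero    g = tt
build (suc m) g = build m g , tabulateRel (g m)

relUpTo-here : ∀ {n} m (D : DataUpTo n m) R (x y : Tuple n (suc m)) →
  relUpTo (suc m) (D , R) m x y ≡ relAt R x y
relUpTo-here m D R x y with m ℕ.≟ m
... | yes refl = refl
... | no m≢m   = ⊥-elim (m≢m refl)

relUpTo-there : ∀ {n} m (D : DataUpTo n m) R k → k ≢ m → ∀ (x y : Tuple n (suc k)) →
  relUpTo (suc m) (D , R) k x y ≡ relUpTo m D k x y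
relUpTo-there m D R k k≢m x y with k ℕ.≟ m
... | yes k≡m = ⊥-elim (k≢m k≡m)
... | no _    = refl

<-suc-≢ : ∀ {k m} → k < suc m → k ≢ m → k < m
<-suc-≢ (s≤s k≤m) = ℕ.≤∧≢⇒< k≤m

relUpTo-build : ∀ {n} m (g : RelFamily n) k → k < m → ∀ x y → relUpTo m (build m g) k x y ≡ g k x y
relUpTo-build (suc m) g k k<m x y with k ℕ.≟ m
... | yes refl = relAt-tabulateRel (g k) x y
... | no k≢m   = relUpTo-build m g k (<-suc-≢ k<m k≢m) x y

checkUpTo-build : ∀ {n} m (g : RelFamily n) → (∀ k → k < m → IsCPZ (g k)) → checkUpTo m (build m g) ≡ true
checkUpTo-build zero    g _   = refl
checkUpTo-build {n} (suc m) g cpz =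
  ∧-intro (checkUpTo-build m g λ k k<m → cpz k (ℕ.m<n⇒m<1+n k<m))
    (cpzRelB-complete n (suc m) _ (IsCPZ-resp (λ x y → sym (relAt-tabulateRel (g m) x y)) (cpz m ℕ.≤-refl)))

checkUpTo-sound : ∀ {n} m (D : DataUpTo n m) → checkUpTo m D ≡ true → ∀ k → k < m → IsCPZ (relUpTo m D k)
checkUpTo-sound {n} (suc m) (D , R) h k k<m with k ℕ.≟ m
... | yes refl = cpzRelB-sound n (suc m) _ (∧-conicalʳ (checkUpTo m D) _ h)
... | no k≢m   = checkUpTo-sound m D (∧-conicalˡ _ _ h) k (<-suc-≢ k<m k≢m)

relUpTo-ext : ∀ {n} m (D D' : DataUpTo n m) →
  (∀ k → k < m → ∀ x y → relUpTo m D k x y ≡ relUpTo m D' k x y) → D ≡ D'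
relUpTo-ext zero    tt      tt        _    = refl
relUpTo-ext (suc m) (D , R) (D' , R') D≗D' = cong₂ _,_
  (relUpTo-ext m D D' λ k k<m x y →
     trans (sym (relUpTo-there m D R k (ℕ.<⇒≢ k<m) x y))
       (trans (D≗D' k (ℕ.m<n⇒m<1+n k<m) x y) (relUpTo-there m D' R' k (ℕ.<⇒≢ k<m) x y)))
  (relAt-ext R R' λ x y →
     trans (sym (relUpTo-here m D R x y)) (trans (D≗D' m ℕ.≤-refl x y) (relUpTo-here m D' R' x y)))

oneOf : ∀ {n k} (a b c d : Tuple n k) → Tuple n k → Bool
oneOf a b c d x = (x == a) ∨ ((x == b) ∨ ((x == c) ∨ (x == d)))

module _ {n k} (a b c d : Tuple n k) where

  oneOf⁻ : ∀ {x} → oneOf a b c d x ≡ true → x ≡ a ⊎ (x ≡ b ⊎ (x ≡ c ⊎ x ≡ d))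
  oneOf⁻ {x} h with ∨-elim {x == a} h
  ... | inj₁ e = inj₁ (==⇒≡ e)
  ... | inj₂ h′ with ∨-elim {x == b} h′
  ... | inj₁ e = inj₂ (inj₁ (==⇒≡ e))
  ... | inj₂ h″ with ∨-elim {x == c} h″
  ... | inj₁ e = inj₂ (inj₂ (inj₁ (==⇒≡ e)))
  ... | inj₂ e = inj₂ (inj₂ (inj₂ (==⇒≡ e)))

  oneOf-false : ∀ x → (x == a) ≡ false → (x == b) ≡ false → (x == c) ≡ false → (x == d) ≡ false →
    oneOf a b c d x ≡ false
  oneOf-false _ e₁ e₂ e₃ e₄ rewrite e₁ | e₂ | e₃ | e₄ = refl

  oneOf-false⁻ : ∀ {x} → oneOf a b c d x ≡ false →
    (x == a) ≡ false × (x == b) ≡ false × (x == c) ≡ false × (x == d) ≡ false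
  oneOf-false⁻ {x} h =
    ∨-conicalˡ (x == a) _ h , ∨-conicalˡ (x == b) _ h₂ , ∨-conicalˡ (x == c) _ h₃ , ∨-conicalʳ (x == c) _ h₃
    where
    h₂ = ∨-conicalʳ (x == a) _ h
    h₃ = ∨-conicalʳ (x == b) _ h₂

  oneOf-2nd : oneOf a b c d b ≡ true
  oneOf-2nd = ∨-introʳ {b == a} (∨-introˡ (==-refl b))

  oneOf-3rd : oneOf a b c d c ≡ true
  oneOf-3rd = ∨-introʳ {c == a} (∨-introʳ {c == b} (∨-introˡ (==-refl c)))

  oneOf-4th : oneOf a b c d d ≡ true
  oneOf-4th = ∨-introʳ {d == a} (∨-introʳ {d == b} (∨-introʳ {d == c} (==-refl d)))

-- The tuples s₁, …, s₄ are made into one new class, and each tⱼ takes over the old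
-- class of sⱼ.  If the tⱼ all lie in the class of p, no information is lost.
module Recode {n k} (s₁ s₂ s₃ s₄ t₁ t₂ t₃ t₄ p : Tuple n k) where

  isS isT : Tuple n k → Bool
  isS = oneOf s₁ s₂ s₃ s₄
  isT = oneOf t₁ t₂ t₃ t₄

  t↦s s↦t T↦p : Tuple n k → Tuple n k
  t↦s x = if x == t₁ then s₁ else if x == t₂ then s₂ else if x == t₃ then s₃ else if x == t₄ then s₄ else x
  s↦t x = if x == s₁ then t₁ else if x == s₂ then t₂ else if x == s₃ then t₃ else if x == s₄ then t₄ else x
  T↦p x = if isT x then p else x

  recoded : BRel n k → BRel n k
  recoded r = adjoinNonInj (adjoinClass isS λ x y → r (t↦s x) (t↦s y))

  recoded-isCPZ : ∀ {r} → IsCPZ r → IsCPZ (recoded r)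
  recoded-isCPZ C =
    adjoinNonInj-isCPZ (adjoinClass-isEquivalenceᵇ isS (IsEquivalenceᵇ-∘ t↦s (IsCPZ.isEquivalenceᵇ C)))

  recoded-S : ∀ r s x → injB s ≡ true → isS s ≡ true → injB x ≡ true → recoded r s x ≡ isS x
  recoded-S r _ _ s-inj s∈S x-inj rewrite s-inj | s∈S | x-inj = refl

  isS⁻ : ∀ {x} → isS x ≡ true → x ≡ s₁ ⊎ (x ≡ s₂ ⊎ (x ≡ s₃ ⊎ x ≡ s₄))
  isS⁻ {x} = oneOf⁻ s₁ s₂ s₃ s₄ {x}

  s₂∈S : isS s₂ ≡ true
  s₂∈S = oneOf-2nd s₁ s₂ s₃ s₄

  s₃∈S : isS s₃ ≡ true
  s₃∈S = oneOf-3rd s₁ s₂ s₃ s₄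

  s₄∈S : isS s₄ ≡ true
  s₄∈S = oneOf-4th s₁ s₂ s₃ s₄

  ∉S : ∀ x → (x == s₁) ≡ false → (x == s₂) ≡ false → (x == s₃) ≡ false → (x == s₄) ≡ false → isS x ≡ false
  ∉S = oneOf-false s₁ s₂ s₃ s₄

  ∉T : ∀ x → (x == t₁) ≡ false → (x == t₂) ≡ false → (x == t₃) ≡ false → (x == t₄) ≡ false → isT x ≡ false
  ∉T = oneOf-false t₁ t₂ t₃ t₄

  isT-elim : ∀ (P : Tuple n k → Set) → P t₁ → P t₂ → P t₃ → P t₄ → ∀ x → isT x ≡ true → P x
  isT-elim P P₁ P₂ P₃ P₄ x x∈T with oneOf⁻ t₁ t₂ t₃ t₄ {x} x∈T
  ... | inj₁ refl               = P₁
  ... | inj₂ (inj₁ refl)        = P₂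
  ... | inj₂ (inj₂ (inj₁ refl)) = P₃
  ... | inj₂ (inj₂ (inj₂ refl)) = P₄

  record Admissible : Set where
    field
      t₁∉S : isS t₁ ≡ false
      t₂∉S : isS t₂ ≡ false
      t₃∉S : isS t₃ ≡ false
      t₄∉S : isS t₄ ≡ false
      t₂≢t₁ : (t₂ == t₁) ≡ false
      t₃≢t₁ : (t₃ == t₁) ≡ false
      t₃≢t₂ : (t₃ == t₂) ≡ false
      t₄≢t₁ : (t₄ == t₁) ≡ false
      t₄≢t₂ : (t₄ == t₂) ≡ false
      t₄≢t₃ : (t₄ == t₃) ≡ false
      t₁-inj : injB t₁ ≡ true
      t₂-inj : injB t₂ ≡ true
      t₃-inj : injB t₃ ≡ true
      t₄-inj : injB t₄ ≡ true
      s₁-inj : injB s₁ ≡ true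
      s₂-inj : injB s₂ ≡ true
      s₃-inj : injB s₃ ≡ true
      s₄-inj : injB s₄ ≡ true
      p∉T : isT p ≡ false

  module _ (adm : Admissible) where
    open Admissible adm

    t↦s-∉T : ∀ x → isT x ≡ false → t↦s x ≡ x
    t↦s-∉T x x∉T with oneOf-false⁻ t₁ t₂ t₃ t₄ {x} x∉T
    ... | e₁ , e₂ , e₃ , e₄ rewrite e₁ | e₂ | e₃ | e₄ = refl

    s↦t-∉T : ∀ x → isT x ≡ false → isS (s↦t x) ≡ false × t↦s (s↦t x) ≡ x × injB (s↦t x) ≡ injB x
    s↦t-∉T x x∉T with x == s₁ in e₁
    ... | true rewrite ==⇒≡ e₁ | ==-refl t₁ = t₁∉S , refl , trans t₁-inj (sym s₁-inj)
    ... | false with x == s₂ in e₂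
    ... | true rewrite ==⇒≡ e₂ | t₂≢t₁ | ==-refl t₂ = t₂∉S , refl , trans t₂-inj (sym s₂-inj)
    ... | false with x == s₃ in e₃
    ... | true rewrite ==⇒≡ e₃ | t₃≢t₁ | t₃≢t₂ | ==-refl t₃ = t₃∉S , refl , trans t₃-inj (sym s₃-inj)
    ... | false with x == s₄ in e₄
    ... | true rewrite ==⇒≡ e₄ | t₄≢t₁ | t₄≢t₂ | t₄≢t₃ | ==-refl t₄ = t₄∉S , refl , trans t₄-inj (sym s₄-inj)
    ... | false = ∉S x e₁ e₂ e₃ e₄ , t↦s-∉T x x∉T , refl

    T↦p-∉T : ∀ x → isT (T↦p x) ≡ false
    T↦p-∉T x with isT x in x∈T
    ... | true  = p∉T
    ... | false = x∈T

    module _ {r : BRel n k} (C : IsCPZ r)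
             (p~t₁ : r p t₁ ≡ true) (p~t₂ : r p t₂ ≡ true) (p~t₃ : r p t₃ ≡ true) (p~t₄ : r p t₄ ≡ true) where
      private module C = IsCPZ C

      recoded-s↦t : ∀ x y → isT x ≡ false → isT y ≡ false → recoded r (s↦t x) (s↦t y) ≡ r x y
      recoded-s↦t x y x∉T y∉T with s↦t-∉T x x∉T | s↦t-∉T y y∉T
      ... | x′∉S , x′↦x , x′-inj | y′∉S , y′↦y , y′-inj =
        trans core (IsCPZ⇒adjoinNonInj-≡ C x y)
        where
        core : recoded r (s↦t x) (s↦t y) ≡ adjoinNonInj r x y
        core rewrite x′∉S | y′∉S | x′↦x | y′↦y | x′-inj | y′-inj = refl

      T↦p-resp : ∀ x y → r x y ≡ r (T↦p x) y
      T↦p-resp x y with isT x in x∈T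
      ... | true  = C.respˡ x p y (C.symmetric p x (isT-elim (λ t → r p t ≡ true) p~t₁ p~t₂ p~t₃ p~t₄ x x∈T))
      ... | false = refl

      recoded-decode : ∀ x y → r x y ≡ recoded r (s↦t (T↦p x)) (s↦t (T↦p y))
      recoded-decode x y = begin
        r x y                 ≡⟨ T↦p-resp x y ⟩
        r (T↦p x) y           ≡⟨ C.symmetric-≡ (T↦p x) y ⟩
        r y (T↦p x)           ≡⟨ T↦p-resp y (T↦p x) ⟩
        r (T↦p y) (T↦p x)     ≡⟨ C.symmetric-≡ (T↦p y) (T↦p x) ⟩
        r (T↦p x) (T↦p y)     ≡⟨ recoded-s↦t (T↦p x) (T↦p y) (T↦p-∉T x) (T↦p-∉T y) ⟨
        recoded r (s↦t (T↦p x)) (s↦t (T↦p y)) ∎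
        where open ≡-Reasoning

ands : ∀ {v} → List (Formula v) → Formula v
ands L.[]       = neg ff
ands (f L.∷ fs) = and f (ands fs)

neq : ∀ {v} → Fin v → Fin v → Formula v
neq i j = neg (eq i j)

φ-matrix : List (Formula 6)
φ-matrix =
  E₂[xy,x w₁ ] L.∷ E₂[xy,x w₂ ] L.∷ E₂[xy,x w₃ ] L.∷ E₂[xy,x w₄ ] L.∷
  neq w₁ x L.∷ neq w₁ y L.∷ neq w₂ x L.∷ neq w₂ y L.∷
  neq w₃ x L.∷ neq w₃ y L.∷ neq w₄ x L.∷ neq w₄ y L.∷
  neq w₁ w₂ L.∷ neq w₁ w₃ L.∷ neq w₁ w₄ L.∷ neq w₂ w₃ L.∷ neq w₂ w₄ L.∷ neq w₃ w₄ L.∷ L.[]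
  where
  x y w₁ w₂ w₃ w₄ : Fin 6
  x = F.# 5 ; y = F.# 4 ; w₁ = F.# 3 ; w₂ = F.# 2 ; w₃ = F.# 1 ; w₄ = F.# 0
  E₂[xy,x_] : Fin 6 → Formula 6
  E₂[xy,x_] w = relE 1 (x ∷ y ∷ []) (x ∷ w ∷ [])

∃witnesses : Formula 2
∃witnesses = ex∃ (ex∃ (ex∃ (ex∃ (ands φ-matrix))))

φ : Sentence
φ = all∀ (all∀ (imp (neq (F.# 1) (F.# 0)) ∃witnesses))

module _ {n} (A : FinStr n) where

  evalB-all∀⁻ : ∀ {v} (ψ : Formula (suc v)) {ρ} → evalB A (all∀ ψ) ρ ≡ true → ∀ a → evalB A ψ (a ∷ ρ) ≡ true
  evalB-all∀⁻ _ h a = all-true⁻ _ h (∈-allFin a)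

  evalB-ex∃⁻ : ∀ {v} (ψ : Formula (suc v)) {ρ} → evalB A (ex∃ ψ) ρ ≡ true →
    Σ (Fin n) λ a → evalB A ψ (a ∷ ρ) ≡ true
  evalB-ex∃⁻ _ h with any-true⁻ _ (allFin n) h
  ... | a , _ , ψa = a , ψa

  evalB-ands⁻ : ∀ {v} (fs : List (Formula v)) {ρ} → evalB A (ands fs) ρ ≡ true →
    All (λ f → evalB A f ρ ≡ true) fs
  evalB-ands⁻ L.[]       _ = All.[]
  evalB-ands⁻ (f L.∷ fs) h = ∧-conicalˡ _ _ h All.∷ evalB-ands⁻ fs (∧-conicalʳ (evalB A f _) _ h)

not-isYes-≟⇒≢ : ∀ {n} {a b : Fin n} → not ⌊ a ≟ᶠ b ⌋ ≡ true → a ≢ b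
not-isYes-≟⇒≢ {a = a} {b} h = isYes-false⁻ (a ≟ᶠ b) (not-injective h)

-- The default z is a junk value, returned only for lists with fewer than four entries.
firstFour : ∀ {A : Set} → A → List A → A × A × A × A
firstFour _ (a L.∷ b L.∷ c L.∷ d L.∷ _) = a , b , c , d
firstFour z _                           = z , z , z , z

fourList : ∀ {A : Set} → A × A × A × A → List A
fourList w = proj₁ w L.∷ proj₁ (proj₂ w) L.∷ proj₁ (proj₂ (proj₂ w)) L.∷ proj₂ (proj₂ (proj₂ w)) L.∷ L.[]

firstFour≡take : ∀ {A : Set} (z : A) xs → 4 ≤ length xs → fourList (firstFour z xs) ≡ L.take 4 xs
firstFour≡take z (a L.∷ b L.∷ c L.∷ d L.∷ _) _ = refl
firstFour≡take z L.[]                          ()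
firstFour≡take z (_ L.∷ L.[])                  (s≤s ())
firstFour≡take z (_ L.∷ _ L.∷ L.[])            (s≤s (s≤s ()))
firstFour≡take z (_ L.∷ _ L.∷ _ L.∷ L.[])      (s≤s (s≤s (s≤s ())))

module Witnesses (n₀ : ℕ) where

  N : ℕ
  N = suc (suc n₀)

  0F 1F : Fin N
  0F = F.zero
  1F = F.suc F.zero

  p : Tuple N 2
  p = 0F ∷ 1F ∷ []

  isCandidate : FinStr N → Fin N → Bool
  isCandidate D w = finRel D 1 p (0F ∷ w ∷ []) ∧ (not ⌊ w ≟ᶠ 0F ⌋ ∧ not ⌊ w ≟ᶠ 1F ⌋)

  candidates : FinStr N → List (Fin N)
  candidates D = filterᵇ (isCandidate D) (allFin N)

  matrix⇒four-candidates : ∀ D {w₁ w₂ w₃ w₄} →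
    All (λ f → evalB D f (w₄ ∷ w₃ ∷ w₂ ∷ w₁ ∷ 1F ∷ 0F ∷ []) ≡ true) φ-matrix → 4 ≤ length (candidates D)
  matrix⇒four-candidates D {w₁} {w₂} {w₃} {w₄}
    (r₁ All.∷ r₂ All.∷ r₃ All.∷ r₄ All.∷ w₁≢0 All.∷ w₁≢1 All.∷ w₂≢0 All.∷ w₂≢1 All.∷
     w₃≢0 All.∷ w₃≢1 All.∷ w₄≢0 All.∷ w₄≢1 All.∷
     w₁≢w₂ All.∷ w₁≢w₃ All.∷ w₁≢w₄ All.∷ w₂≢w₃ All.∷ w₂≢w₄ All.∷ w₃≢w₄ All.∷ All.[]) =
    unique-⊆⇒length-≤ ws (candidates D) ws-unique ws⊆candidates
    where
    ws : List (Fin N)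
    ws = w₁ L.∷ w₂ L.∷ w₃ L.∷ w₄ L.∷ L.[]
    ws-unique : Unique ws
    ws-unique = (not-isYes-≟⇒≢ w₁≢w₂ All.∷ not-isYes-≟⇒≢ w₁≢w₃ All.∷ not-isYes-≟⇒≢ w₁≢w₄ All.∷ All.[])
      AllPairs.∷ (not-isYes-≟⇒≢ w₂≢w₃ All.∷ not-isYes-≟⇒≢ w₂≢w₄ All.∷ All.[])
      AllPairs.∷ (not-isYes-≟⇒≢ w₃≢w₄ All.∷ All.[]) AllPairs.∷ All.[] AllPairs.∷ AllPairs.[]
    isCandidate-ws : ∀ {w} → w ∈ ws → isCandidate D w ≡ true
    isCandidate-ws (here refl)                         = ∧-intro r₁ (∧-intro w₁≢0 w₁≢1)
    isCandidate-ws (there (here refl))                 = ∧-intro r₂ (∧-intro w₂≢0 w₂≢1)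
    isCandidate-ws (there (there (here refl)))         = ∧-intro r₃ (∧-intro w₃≢0 w₃≢1)
    isCandidate-ws (there (there (there (here refl)))) = ∧-intro r₄ (∧-intro w₄≢0 w₄≢1)
    ws⊆candidates : ∀ {w} → w ∈ ws → w ∈ candidates D
    ws⊆candidates w∈ws = ∈-filter⁺ (T? ∘ isCandidate D) (∈-allFin _) (≡true⇒T (isCandidate-ws w∈ws))

  φ⇒four-candidates : ∀ D → evalB D φ [] ≡ true → 4 ≤ length (candidates D)
  φ⇒four-candidates D h = matrix⇒four-candidates D {proj₁ ∃w₁} {proj₁ ∃w₂} {proj₁ ∃w₃} {proj₁ ∃w₄}
    (evalB-ands⁻ D φ-matrix (proj₂ ∃w₄))
    where
    ∃w₁ = evalB-ex∃⁻ D (ex∃ (ex∃ (ex∃ (ands φ-matrix)))) {1F ∷ 0F ∷ []}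
            (⇒ᵇ-elim {not ⌊ 0F ≟ᶠ 1F ⌋} {evalB D ∃witnesses (1F ∷ 0F ∷ [])}
              (evalB-all∀⁻ D (imp (neq (F.# 1) (F.# 0)) ∃witnesses) {0F ∷ []}
                (evalB-all∀⁻ D (all∀ (imp (neq (F.# 1) (F.# 0)) ∃witnesses)) {[]} h 0F) 1F) refl)
    ∃w₂ = evalB-ex∃⁻ D (ex∃ (ex∃ (ands φ-matrix))) {proj₁ ∃w₁ ∷ 1F ∷ 0F ∷ []} (proj₂ ∃w₁)
    ∃w₃ = evalB-ex∃⁻ D (ex∃ (ands φ-matrix)) {proj₁ ∃w₂ ∷ proj₁ ∃w₁ ∷ 1F ∷ 0F ∷ []} (proj₂ ∃w₂)
    ∃w₄ = evalB-ex∃⁻ D (ands φ-matrix) {proj₁ ∃w₃ ∷ proj₁ ∃w₂ ∷ proj₁ ∃w₁ ∷ 1F ∷ 0F ∷ []} (proj₂ ∃w₃)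

  witnesses : FinStr N → Fin N × Fin N × Fin N × Fin N
  witnesses D = firstFour 0F (candidates D)

  W₁ W₂ W₃ W₄ : FinStr N → Fin N
  W₁ D = proj₁ (witnesses D)
  W₂ D = proj₁ (proj₂ (witnesses D))
  W₃ D = proj₁ (proj₂ (proj₂ (witnesses D)))
  W₄ D = proj₂ (proj₂ (proj₂ (witnesses D)))

  module _ {D w} (h : isCandidate D w ≡ true) where

    isCandidate⇒p~ : finRel D 1 p (0F ∷ w ∷ []) ≡ true
    isCandidate⇒p~ = ∧-conicalˡ _ _ h

    isCandidate⇒≢0 : w ≢ 0F
    isCandidate⇒≢0 = not-isYes-≟⇒≢ (∧-conicalˡ _ _ (∧-conicalʳ (finRel D 1 p (0F ∷ w ∷ [])) _ h))

    isCandidate⇒≢1 : w ≢ 1F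
    isCandidate⇒≢1 = not-isYes-≟⇒≢ (∧-conicalʳ (not ⌊ w ≟ᶠ 0F ⌋) _ (∧-conicalʳ (finRel D 1 p (0F ∷ w ∷ [])) _ h))

  record Witnessing (D : FinStr N) (w : Fin N × Fin N × Fin N × Fin N) : Set where
    field
      ordered     : AllPairs F._<_ (fourList w)
      candidate   : All (λ a → isCandidate D a ≡ true) (fourList w)

  φ⇒witnessing : ∀ D → evalB D φ [] ≡ true → Witnessing D (witnesses D)
  φ⇒witnessing D h = record
    { ordered   = subst (AllPairs F._<_) (sym prefix)
        (AllPairsP.take⁺ 4 (AllPairsP.filter⁺ (T? ∘ isCandidate D) (AllPairsP.tabulate⁺-< (λ i<j → i<j))))
    ; candidate = subst (All _) (sym prefix)
        (All.take⁺ 4 (All.map T⇒≡true (All.all-filter (T? ∘ isCandidate D) (allFin N))))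
    }
    where
    prefix : fourList (witnesses D) ≡ L.take 4 (candidates D)
    prefix = firstFour≡take 0F (candidates D) (φ⇒four-candidates D h)

==-false-head : ∀ {n k} {a a' : Fin n} (v v' : Tuple n k) → a ≢ a' → ((a ∷ v) == (a' ∷ v')) ≡ false
==-false-head _ _ a≢a' = ≢⇒==-false (a≢a' ∘ V.∷-injectiveˡ)

==-false-second : ∀ {n} {a a' b b' : Fin n} → b ≢ b' → ((a ∷ b ∷ []) == (a' ∷ b' ∷ [])) ≡ false
==-false-second b≢b' = ≢⇒==-false (b≢b' ∘ V.∷-injectiveˡ ∘ V.∷-injectiveʳ)

pair-injective : ∀ {n} {a a' b b' : Fin n} → (a ∷ b ∷ []) ≡ (a' ∷ b' ∷ []) → a ≡ a' × b ≡ b'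
pair-injective refl = refl , refl

injB-pair : ∀ {n} {a b : Fin n} → a ≢ b → injB (a ∷ b ∷ []) ≡ true
injB-pair {a = a} {b} a≢b rewrite isYes-false (a ≟ᶠ b) a≢b = refl

-- With p = (0,1), e₀ = (1,0) and witnesses a, b, c, d of φ at (0,1), the index i is stored
-- by making {e₀, (a,b), (c,d), (i+2,0)} an E₂-class; a < c tells (a,b) and (c,d) apart.
module Encoding (n₀ m : ℕ) (m<n₀ : suc m ≤ n₀) where
  open Witnesses n₀

  e₀ : Tuple N 2
  e₀ = 1F ∷ 0F ∷ []

  tag : Fin (suc m) → Fin N
  tag i = F.suc (F.suc (F.inject≤ i m<n₀))

  tag≢0 : ∀ i → tag i ≢ 0F
  tag≢0 i ()

  tag≢1 : ∀ i → tag i ≢ 1F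
  tag≢1 i ()

  module Code (i : Fin (suc m)) (a b c d : Fin N) =
    Recode e₀ (a ∷ b ∷ []) (c ∷ d ∷ []) (tag i ∷ 0F ∷ [])
           (0F ∷ a ∷ []) (0F ∷ b ∷ []) (0F ∷ c ∷ []) (0F ∷ d ∷ []) p

  record Valid (a b c d : Fin N) : Set where
    field
      a≢0 : a ≢ 0F
      b≢0 : b ≢ 0F
      c≢0 : c ≢ 0F
      d≢0 : d ≢ 0F
      a≢1 : a ≢ 1F
      b≢1 : b ≢ 1F
      c≢1 : c ≢ 1F
      d≢1 : d ≢ 1F
      a≢b : a ≢ b
      a≢c : a ≢ c
      a≢d : a ≢ d
      b≢c : b ≢ c
      b≢d : b ≢ d
      c≢d : c ≢ d
      a<c : a F.< c

  admissible : ∀ i {a b c d} → Valid a b c d → Code.Admissible i a b c d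
  admissible i {a} {b} {c} {d} v = record
    { t₁∉S = 0w∉S a ; t₂∉S = 0w∉S b ; t₃∉S = 0w∉S c ; t₄∉S = 0w∉S d
    ; t₂≢t₁ = ==-false-second (≢-sym a≢b) ; t₃≢t₁ = ==-false-second (≢-sym a≢c)
    ; t₃≢t₂ = ==-false-second (≢-sym b≢c) ; t₄≢t₁ = ==-false-second (≢-sym a≢d)
    ; t₄≢t₂ = ==-false-second (≢-sym b≢d) ; t₄≢t₃ = ==-false-second (≢-sym c≢d)
    ; t₁-inj = injB-pair (≢-sym a≢0) ; t₂-inj = injB-pair (≢-sym b≢0)
    ; t₃-inj = injB-pair (≢-sym c≢0) ; t₄-inj = injB-pair (≢-sym d≢0)
    ; s₁-inj = refl ; s₂-inj = injB-pair a≢b ; s₃-inj = injB-pair c≢d ; s₄-inj = injB-pair (tag≢0 i)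
    ; p∉T = Code.∉T i a b c d p (==-false-second (≢-sym a≢1)) (==-false-second (≢-sym b≢1))
                        (==-false-second (≢-sym c≢1)) (==-false-second (≢-sym d≢1))
    }
    where
    open Valid v
    0w∉S : ∀ w → Code.isS i a b c d (0F ∷ w ∷ []) ≡ false
    0w∉S w = Code.∉S i a b c d (0F ∷ w ∷ [])
      (==-false-head {a = 0F} {1F} (w ∷ []) (0F ∷ []) λ ()) (==-false-head (w ∷ []) (b ∷ []) (≢-sym a≢0))
      (==-false-head (w ∷ []) (d ∷ []) (≢-sym c≢0)) (==-false-head (w ∷ []) (0F ∷ []) (≢-sym (tag≢0 i)))

  e₀-class : ∀ i a b c d r x → injB x ≡ true → Code.recoded i a b c d r e₀ x ≡ Code.isS i a b c d x
  e₀-class i a b c d r x = Code.recoded-S i a b c d r e₀ x refl refl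

  Code-injective : ∀ {i a b c d i' a' b' c' d'} r r' → Valid a b c d → Valid a' b' c' d' →
    (∀ x y → Code.recoded i a b c d r x y ≡ Code.recoded i' a' b' c' d' r' x y) →
    i ≡ i' × a ≡ a' × b ≡ b' × c ≡ c' × d ≡ d'
  Code-injective {i} {a} {b} {c} {d} {i'} {a'} {b'} {c'} {d'} r r' v v' same = i≡i' , ab≡a'b'×cd≡c'd'
    where
    module v = Valid v
    module v' = Valid v'
    S⊆S' : ∀ x → injB x ≡ true → Code.isS i a b c d x ≡ true →
      x ≡ e₀ ⊎ (x ≡ a' ∷ b' ∷ [] ⊎ (x ≡ c' ∷ d' ∷ [] ⊎ x ≡ tag i' ∷ 0F ∷ []))
    S⊆S' x x-inj x∈S = Code.isS⁻ i' a' b' c' d' (trans (sym (e₀-class i' a' b' c' d' r' x x-inj))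
      (trans (sym (same e₀ x)) (trans (e₀-class i a b c d r x x-inj) x∈S)))
    i≡i' : i ≡ i'
    i≡i' with S⊆S' (tag i ∷ 0F ∷ []) (injB-pair (tag≢0 i)) (Code.s₄∈S i a b c d)
    ... | inj₁ e                = ⊥-elim (tag≢1 i (proj₁ (pair-injective e)))
    ... | inj₂ (inj₁ e)         = ⊥-elim (v'.b≢0 (sym (proj₂ (pair-injective e))))
    ... | inj₂ (inj₂ (inj₁ e))  = ⊥-elim (v'.d≢0 (sym (proj₂ (pair-injective e))))
    ... | inj₂ (inj₂ (inj₂ e))  =
      F.inject≤-injective m<n₀ m<n₀ i i' (F.suc-injective (F.suc-injective (proj₁ (pair-injective e))))
    ab≡a'b'×cd≡c'd' : a ≡ a' × b ≡ b' × c ≡ c' × d ≡ d'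
    ab≡a'b'×cd≡c'd' with S⊆S' (a ∷ b ∷ []) (injB-pair v.a≢b) (Code.s₂∈S i a b c d) | S⊆S' (c ∷ d ∷ []) (injB-pair v.c≢d) (Code.s₃∈S i a b c d)
    ... | inj₁ e                 | _                      = ⊥-elim (v.b≢0 (proj₂ (pair-injective e)))
    ... | inj₂ (inj₂ (inj₂ e))   | _                      = ⊥-elim (v.b≢0 (proj₂ (pair-injective e)))
    ... | _                      | inj₁ e                 = ⊥-elim (v.d≢0 (proj₂ (pair-injective e)))
    ... | _                      | inj₂ (inj₂ (inj₂ e))   = ⊥-elim (v.d≢0 (proj₂ (pair-injective e)))
    ... | inj₂ (inj₁ e₁)         | inj₂ (inj₂ (inj₁ e₂))  =
      proj₁ (pair-injective e₁) , proj₂ (pair-injective e₁) , proj₁ (pair-injective e₂) , proj₂ (pair-injective e₂)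
    ... | inj₂ (inj₁ e₁)         | inj₂ (inj₁ e₂)         =
      ⊥-elim (v.a≢c (trans (proj₁ (pair-injective e₁)) (sym (proj₁ (pair-injective e₂)))))
    ... | inj₂ (inj₂ (inj₁ e₁))  | inj₂ (inj₂ (inj₁ e₂))  =
      ⊥-elim (v.a≢c (trans (proj₁ (pair-injective e₁)) (sym (proj₁ (pair-injective e₂)))))
    ... | inj₂ (inj₂ (inj₁ e₁))  | inj₂ (inj₁ e₂)         =
      ⊥-elim (F.<-asym v.a<c (subst₂ F._<_ (sym (proj₁ (pair-injective e₂))) (sym (proj₁ (pair-injective e₁))) v'.a<c))

  Witnessing⇒Valid : ∀ {D a b c d} → Witnessing D (a , b , c , d) → Valid a b c d
  Witnessing⇒Valid record
    { ordered   = (a<b All.∷ a<c All.∷ a<d All.∷ All.[]) AllPairs.∷ (b<c All.∷ b<d All.∷ All.[]) AllPairs.∷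
                  (c<d All.∷ All.[]) AllPairs.∷ All.[] AllPairs.∷ AllPairs.[]
    ; candidate = ca All.∷ cb All.∷ cc All.∷ cd All.∷ All.[]
    } = record
    { a≢0 = isCandidate⇒≢0 ca ; b≢0 = isCandidate⇒≢0 cb ; c≢0 = isCandidate⇒≢0 cc ; d≢0 = isCandidate⇒≢0 cd
    ; a≢1 = isCandidate⇒≢1 ca ; b≢1 = isCandidate⇒≢1 cb ; c≢1 = isCandidate⇒≢1 cc ; d≢1 = isCandidate⇒≢1 cd
    ; a≢b = F.<⇒≢ a<b ; a≢c = F.<⇒≢ a<c ; a≢d = F.<⇒≢ a<d
    ; b≢c = F.<⇒≢ b<c ; b≢d = F.<⇒≢ b<d ; c≢d = F.<⇒≢ c<d
    ; a<c = a<c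
    }

  recoded-injective : ∀ {i a b c d i' a' b' c' d'} {r r' : BRel N 2} → IsCPZ r → IsCPZ r' →
    Valid a b c d → Valid a' b' c' d' →
    All (λ w → r p (0F ∷ w ∷ []) ≡ true) (a L.∷ b L.∷ c L.∷ d L.∷ L.[]) →
    All (λ w → r' p (0F ∷ w ∷ []) ≡ true) (a' L.∷ b' L.∷ c' L.∷ d' L.∷ L.[]) →
    (∀ x y → Code.recoded i a b c d r x y ≡ Code.recoded i' a' b' c' d' r' x y) →
    i ≡ i' × (∀ x y → r x y ≡ r' x y)
  recoded-injective {i} {a} {b} {c} {d} {r = r} {r'} C C' v v'
    (p~a All.∷ p~b All.∷ p~c All.∷ p~d All.∷ All.[]) (p~a' All.∷ p~b' All.∷ p~c' All.∷ p~d' All.∷ All.[]) same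
    with Code-injective r r' v v' same
  ... | refl , refl , refl , refl , refl = refl , λ x y → begin
    r x y                  ≡⟨ Code.recoded-decode i a b c d (admissible i v) C p~a p~b p~c p~d x y ⟩
    Code.recoded i a b c d r (code x) (code y)  ≡⟨ same (code x) (code y) ⟩
    Code.recoded i a b c d r' (code x) (code y) ≡⟨ Code.recoded-decode i a b c d (admissible i v') C' p~a' p~b' p~c' p~d' x y ⟨
    r' x y                 ∎
    where
    open ≡-Reasoning
    code : Tuple N 2 → Tuple N 2
    code x = Code.s↦t i a b c d (Code.T↦p i a b c d x)

  Models : FinStr N → Set
  Models D = (checkCPZ D ∧ evalB D φ []) ≡ true

  module _ {D} (D⊨ : Models D) where

    Models⇒isCPZ : ∀ k → k < N → IsCPZ (finRel D k)
    Models⇒isCPZ = checkUpTo-sound N D (∧-conicalˡ _ _ D⊨)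

    Models⇒Witnessing : Witnessing D (witnesses D)
    Models⇒Witnessing = φ⇒witnessing D (∧-conicalʳ (checkCPZ D) _ D⊨)

    Models⇒Valid : Valid (W₁ D) (W₂ D) (W₃ D) (W₄ D)
    Models⇒Valid = Witnessing⇒Valid Models⇒Witnessing

    Models⇒p~ : All (λ w → finRel D 1 p (0F ∷ w ∷ []) ≡ true) (W₁ D L.∷ W₂ D L.∷ W₃ D L.∷ W₄ D L.∷ L.[])
    Models⇒p~ = All.map isCandidate⇒p~ (Witnessing.candidate Models⇒Witnessing)

  recodedFamily : Fin (suc m) → FinStr N → RelFamily N
  recodedFamily i D zero          = finRel D 0
  recodedFamily i D (suc zero)    = Code.recoded i (W₁ D) (W₂ D) (W₃ D) (W₄ D) (finRel D 1)
  recodedFamily i D (suc (suc k)) = finRel D (suc (suc k))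

  recode : Fin (suc m) → FinStr N → FinStr N
  recode i D = build N (recodedFamily i D)

  1<N : 1 < N
  1<N = s≤s (s≤s z≤n)

  recode-checkCPZ : ∀ i {D} → checkCPZ D ≡ true → checkCPZ (recode i D) ≡ true
  recode-checkCPZ i {D} D∈K = checkUpTo-build N (recodedFamily i D) isCPZ
    where
    isCPZ : ∀ k → k < N → IsCPZ (recodedFamily i D k)
    isCPZ zero          k<N = checkUpTo-sound N D D∈K 0 k<N
    isCPZ (suc zero)    k<N = Code.recoded-isCPZ i (W₁ D) (W₂ D) (W₃ D) (W₄ D) (checkUpTo-sound N D D∈K 1 k<N)
    isCPZ (suc (suc k)) k<N = checkUpTo-sound N D D∈K (suc (suc k)) k<N

  recode-injective : ∀ {i D i' D'} → Models D → Models D' → recode i D ≡ recode i' D' → i ≡ i' × D ≡ D'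
  recode-injective {i} {D} {i'} {D'} D⊨ D'⊨ same = proj₁ E₂-agree , relUpTo-ext N D D' relations-same
    where
    family-same : ∀ k → k < N → ∀ x y → recodedFamily i D k x y ≡ recodedFamily i' D' k x y
    family-same k k<N x y = trans (sym (relUpTo-build N (recodedFamily i D) k k<N x y))
      (trans (cong (λ X → finRel X k x y) same) (relUpTo-build N (recodedFamily i' D') k k<N x y))
    E₂-agree = recoded-injective {i} {W₁ D} {W₂ D} {W₃ D} {W₄ D} {i'} {W₁ D'} {W₂ D'} {W₃ D'} {W₄ D'}
      {finRel D 1} {finRel D' 1} (Models⇒isCPZ D⊨ 1 1<N) (Models⇒isCPZ D'⊨ 1 1<N)
      (Models⇒Valid D⊨) (Models⇒Valid D'⊨) (Models⇒p~ D⊨) (Models⇒p~ D'⊨) (family-same 1 1<N)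
    relations-same : ∀ k → k < N → ∀ x y → finRel D k x y ≡ finRel D' k x y
    relations-same zero          = family-same 0
    relations-same (suc zero)    _ = proj₂ E₂-agree
    relations-same (suc (suc k)) = family-same (suc (suc k))

  discrete : FinStr N
  discrete = build N λ _ → adjoinNonInj _==_

  discrete-checkCPZ : checkCPZ discrete ≡ true
  discrete-checkCPZ = checkUpTo-build N _ λ _ _ → adjoinNonInj-isCPZ ==-isEquivalenceᵇ

  recode≢discrete : ∀ i {D} → Models D → recode i D ≢ discrete
  recode≢discrete i {D} D⊨ same = contradiction (begin
    true                        ≡⟨ recoded-e₀ab ⟨
    finRel (recode i D) 1 e₀ ab ≡⟨ cong (λ X → finRel X 1 e₀ ab) same ⟩
    finRel discrete 1 e₀ ab     ≡⟨ discrete-e₀ab ⟩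
    false                       ∎) λ ()
    where
    open ≡-Reasoning
    open Valid (Models⇒Valid D⊨)
    ab : Tuple N 2
    ab = W₁ D ∷ W₂ D ∷ []
    recoded-e₀ab : finRel (recode i D) 1 e₀ ab ≡ true
    recoded-e₀ab = trans (relUpTo-build N (recodedFamily i D) 1 1<N e₀ ab)
      (trans (e₀-class i (W₁ D) (W₂ D) (W₃ D) (W₄ D) (finRel D 1) ab (injB-pair a≢b)) (Code.s₂∈S i (W₁ D) (W₂ D) (W₃ D) (W₄ D)))
    discrete-e₀ab : finRel discrete 1 e₀ ab ≡ false
    discrete-e₀ab = trans (relUpTo-build N (λ _ → adjoinNonInj _==_) 1 1<N e₀ ab)
      (trans (adjoinNonInj-injective {s = _==_} e₀ ab refl (injB-pair a≢b)) (==-false-second {a = 1F} {W₁ D} (≢-sym b≢0)))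

  modelsφ structuresK : List (FinStr N)
  modelsφ = filterᵇ (λ A → checkCPZ A ∧ evalB A φ []) (allData N N)
  structuresK = filterᵇ (λ A → checkCPZ A) (allData N N)

  pairs : List (Fin (suc m) × FinStr N)
  pairs = cartesianProduct (allFin (suc m)) modelsφ

  pairs-unique : Unique pairs
  pairs-unique = Unique.cartesianProduct⁺ (Unique.allFin⁺ (suc m))
    (Unique.filter⁺ (T? ∘ λ A → checkCPZ A ∧ evalB A φ []) (allData-unique N N))

  length-pairs : length pairs ≡ length modelsφ * suc m
  length-pairs = trans (length-cartesianProduct (allFin (suc m)) modelsφ)
    (trans (cong (_* length modelsφ) (L.length-tabulate {n = suc m} (λ i → i))) (ℕ.*-comm (suc m) (length modelsφ)))

  ∈pairs⇒Models : ∀ {iD} → iD ∈ pairs → Models (proj₂ iD)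
  ∈pairs⇒Models iD∈ = T⇒≡true (proj₂ (∈-filter⁻ (T? ∘ λ A → checkCPZ A ∧ evalB A φ [])
    {xs = allData N N} (proj₂ (∈-cartesianProduct⁻ (allFin (suc m)) modelsφ iD∈))))

  ∈-structuresK : ∀ {D} → checkCPZ D ≡ true → D ∈ structuresK
  ∈-structuresK {D} D∈K = ∈-filter⁺ (T? ∘ λ A → checkCPZ A) {D} {allData N N} (∈-allData N N D) (≡true⇒T D∈K)

  recode∈structuresK : ∀ {iD} → iD ∈ pairs → recode (proj₁ iD) (proj₂ iD) ∈ structuresK
  recode∈structuresK {i , D} iD∈ = ∈-structuresK {recode i D} (recode-checkCPZ i {D} (∧-conicalˡ (checkCPZ D) _ (∈pairs⇒Models iD∈)))

  recode-injectiveOn : ∀ {iD iD'} → iD ∈ pairs → iD' ∈ pairs →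
    recode (proj₁ iD) (proj₂ iD) ≡ recode (proj₁ iD') (proj₂ iD') → iD ≡ iD'
  recode-injectiveOn {i , D} {i' , D'} iD∈ iD'∈ same =
    let i≡i' , D≡D' = recode-injective {i} {D} {i'} {D'} (∈pairs⇒Models iD∈) (∈pairs⇒Models iD'∈) same
    in cong₂ _,_ i≡i' D≡D'

  countSat*suc<countK : countSat φ N * suc m < countK N
  countSat*suc<countK = subst (_< length structuresK) length-pairs
    (injection-missing⇒length-< pairs structuresK (λ (i , D) → recode i D) pairs-unique recode∈structuresK
      recode-injectiveOn discrete (∈-structuresK discrete-checkCPZ) λ {(i , _)} iD∈ → recode≢discrete i (∈pairs⇒Models iD∈))

⇔-sym : ∀ {A B : Set} → A ⇔ B → B ⇔ A
⇔-sym (f , g) = g , f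

⇔-trans : ∀ {A B C : Set} → A ⇔ B → B ⇔ C → A ⇔ C
⇔-trans (f , g) (f' , g') = f' ∘ f , g ∘ g'

⇔-both : ∀ {A B : Set} → A → B → A ⇔ B
⇔-both a b = (λ _ → b) , (λ _ → a)

⇔-neither : ∀ {A B : Set} → ¬ A → ¬ B → A ⇔ B
⇔-neither ¬a ¬b = ⊥-elim ∘ ¬a , ⊥-elim ∘ ¬b

pigeonhole-nonInj : ∀ {A : Set} (g : Fin 2 → A) k (t : Vec (Fin 2) (suc (suc (suc k)))) → NonInj (V.map g t)
pigeonhole-nonInj g k t with F.pigeonhole (s≤s (s≤s (s≤s z≤n))) (lookup t)
... | i , j , i<j , tᵢ≡tⱼ =
  i , j , F.<⇒≢ i<j , trans (V.lookup-map i g t) (trans (cong g tᵢ≡tⱼ) (sym (V.lookup-map j g t)))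

module PairType (M : Structure) (M-age : AgeInK M) where

  pick : ∀ {k} → Vec (Carrier M) 2 → Vec (Fin 2) k → Vec (Carrier M) k
  pick c t = V.map (lookup c) t

  Distinct : Vec (Carrier M) 2 → Set
  Distinct c = lookup c F.zero ≢ lookup c (F.suc F.zero)

  E₁-bit E₂-bit : Vec (Carrier M) 2 → Set
  E₁-bit c = E M 0 (pick c (F.zero ∷ [])) (pick c (F.suc F.zero ∷ []))
  E₂-bit c = E M 1 (pick c (F.zero ∷ F.suc F.zero ∷ [])) (pick c (F.suc F.zero ∷ F.zero ∷ []))

  module _ (c : Vec (Carrier M) 2) where

    E-refl : ∀ k (t : Vec (Fin 2) (suc k)) → E M k (pick c t) (pick c t)
    E-refl k t = proj₁ (M-age 2 c k t t t)

    E-sym : ∀ k (t t' : Vec (Fin 2) (suc k)) → E M k (pick c t) (pick c t') → E M k (pick c t') (pick c t)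
    E-sym k t t' = proj₁ (proj₂ (M-age 2 c k t t' t))

    E-nonInj : ∀ k (t t' : Vec (Fin 2) (suc k)) → NonInj (pick c t) →
      E M k (pick c t) (pick c t') ⇔ NonInj (pick c t')
    E-nonInj k t t' = proj₂ (proj₂ (proj₂ (M-age 2 c k t t' t)))

    lookup-injective : Distinct c → ∀ i j → lookup c i ≡ lookup c j → i ≡ j
    lookup-injective c-dist F.zero           F.zero           _ = refl
    lookup-injective c-dist F.zero           (F.suc F.zero)   e = ⊥-elim (c-dist e)
    lookup-injective c-dist (F.suc F.zero)   F.zero           e = ⊥-elim (c-dist (sym e))
    lookup-injective c-dist (F.suc F.zero)   (F.suc F.zero)   _ = refl

    pick-nonInj⇔ : Distinct c → ∀ i j → NonInj (pick c (i ∷ j ∷ [])) ⇔ (i ≡ j)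
    pick-nonInj⇔ c-dist i j = to , λ i≡j → F.zero , F.suc F.zero , (λ ()) , cong (lookup c) i≡j
      where
      to : NonInj (pick c (i ∷ j ∷ [])) → i ≡ j
      to (F.zero         , F.zero         , p≢q , _) = ⊥-elim (p≢q refl)
      to (F.zero         , F.suc F.zero   , _   , e) = lookup-injective c-dist i j e
      to (F.suc F.zero   , F.zero         , _   , e) = lookup-injective c-dist i j (sym e)
      to (F.suc F.zero   , F.suc F.zero   , p≢q , _) = ⊥-elim (p≢q refl)

  module _ {c d : Vec (Carrier M) 2} (c-dist : Distinct c) (d-dist : Distinct d) where

    lookup-same : ∀ i j → (lookup c i ≡ lookup c j) ⇔ (lookup d i ≡ lookup d j)
    lookup-same i j = cong (lookup d) ∘ lookup-injective c c-dist i j , cong (lookup c) ∘ lookup-injective d d-dist i j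

    E-same-sym : ∀ k (t t' : Vec (Fin 2) (suc k)) →
      E M k (pick c t) (pick c t') ⇔ E M k (pick d t) (pick d t') →
      E M k (pick c t') (pick c t) ⇔ E M k (pick d t') (pick d t)
    E-same-sym k t t' (f , g) = E-sym d k t t' ∘ f ∘ E-sym c k t' t , E-sym c k t t' ∘ g ∘ E-sym d k t' t

    nonInj-same : ∀ i j → NonInj (pick c (i ∷ j ∷ [])) ⇔ NonInj (pick d (i ∷ j ∷ []))
    nonInj-same i j = ⇔-trans (pick-nonInj⇔ c c-dist i j) (⇔-sym (pick-nonInj⇔ d d-dist i j))

    module _ (E₁-same : E₁-bit c ⇔ E₁-bit d) (E₂-same : E₂-bit c ⇔ E₂-bit d) where

      E₁-pick-same : ∀ (t t' : Vec (Fin 2) 1) → E M 0 (pick c t) (pick c t') ⇔ E M 0 (pick d t) (pick d t')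
      E₁-pick-same (F.zero ∷ [])         (F.zero ∷ [])         = ⇔-both (E-refl c 0 _) (E-refl d 0 _)
      E₁-pick-same (F.zero ∷ [])         (F.suc F.zero ∷ [])   = E₁-same
      E₁-pick-same (F.suc F.zero ∷ [])   (F.zero ∷ [])         = E-same-sym 0 _ _ E₁-same
      E₁-pick-same (F.suc F.zero ∷ [])   (F.suc F.zero ∷ [])   = ⇔-both (E-refl c 0 _) (E-refl d 0 _)

      E₂-injective-pick-same : ∀ i i' j j' → i ≢ i' → j ≢ j' →
        E M 1 (pick c (i ∷ i' ∷ [])) (pick c (j ∷ j' ∷ [])) ⇔ E M 1 (pick d (i ∷ i' ∷ [])) (pick d (j ∷ j' ∷ []))
      E₂-injective-pick-same F.zero (F.suc F.zero) F.zero (F.suc F.zero) _ _ = ⇔-both (E-refl c 1 _) (E-refl d 1 _)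
      E₂-injective-pick-same F.zero (F.suc F.zero) (F.suc F.zero) F.zero _ _ = E₂-same
      E₂-injective-pick-same (F.suc F.zero) F.zero F.zero (F.suc F.zero) _ _ = E-same-sym 1 _ _ E₂-same
      E₂-injective-pick-same (F.suc F.zero) F.zero (F.suc F.zero) F.zero _ _ = ⇔-both (E-refl c 1 _) (E-refl d 1 _)
      E₂-injective-pick-same F.zero         F.zero         _ _ i≢i' _ = ⊥-elim (i≢i' refl)
      E₂-injective-pick-same (F.suc F.zero) (F.suc F.zero) _ _ i≢i' _ = ⊥-elim (i≢i' refl)
      E₂-injective-pick-same _ _ F.zero         F.zero         _ j≢j' = ⊥-elim (j≢j' refl)
      E₂-injective-pick-same _ _ (F.suc F.zero) (F.suc F.zero) _ j≢j' = ⊥-elim (j≢j' refl)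

      E₂-pick-same : ∀ (t t' : Vec (Fin 2) 2) → E M 1 (pick c t) (pick c t') ⇔ E M 1 (pick d t) (pick d t')
      E₂-pick-same t@(i ∷ i' ∷ []) t'@(j ∷ j' ∷ []) with i ≟ᶠ i' | j ≟ᶠ j'
      ... | yes i≡i' | _ =
        ⇔-trans (E-nonInj c 1 t t' (proj₂ (pick-nonInj⇔ c c-dist i i') i≡i'))
          (⇔-trans (nonInj-same j j') (⇔-sym (E-nonInj d 1 t t' (proj₂ (pick-nonInj⇔ d d-dist i i') i≡i'))))
      ... | no i≢i' | yes j≡j' = ⇔-neither (unrelated c c-dist) (unrelated d d-dist)
        where
        unrelated : ∀ e → Distinct e → ¬ E M 1 (pick e t) (pick e t')
        unrelated e e-dist Ett' = i≢i' (proj₁ (pick-nonInj⇔ e e-dist i i')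
          (proj₁ (E-nonInj e 1 t' t (proj₂ (pick-nonInj⇔ e e-dist j j') j≡j')) (E-sym e 1 t t' Ett')))
      ... | no i≢i' | no j≢j' = E₂-injective-pick-same i i' j j' i≢i' j≢j'

      sameBits⇒PartialIso : PartialIso M c d
      sameBits⇒PartialIso = lookup-same , E-pick-same
        where
        E-pick-same : ∀ k (t t' : Vec (Fin 2) (suc k)) → E M k (pick c t) (pick c t') ⇔ E M k (pick d t) (pick d t')
        E-pick-same zero          = E₁-pick-same
        E-pick-same (suc zero)    = E₂-pick-same
        E-pick-same (suc (suc k)) t t' = ⇔-both
          (proj₂ (E-nonInj c _ t t' (pigeonhole-nonInj (lookup c) k t)) (pigeonhole-nonInj (lookup c) k t'))
          (proj₂ (E-nonInj d _ t t' (pigeonhole-nonInj (lookup d) k t)) (pigeonhole-nonInj (lookup d) k t'))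

module SixPoints where

  E₁-class : Bool → Tuple 6 1 → Bool
  E₁-class b₁ u = b₁ ∧ ((u == (F.# 0 ∷ [])) ∨ (u == (F.# 1 ∷ [])))

  E₂-class : Bool → Tuple 6 2 → Bool
  E₂-class b₂ u = (u == (F.# 0 ∷ F.# 1 ∷ [])) ∨ ((u == (F.# 0 ∷ F.# 2 ∷ [])) ∨ ((u == (F.# 0 ∷ F.# 3 ∷ [])) ∨
                  ((u == (F.# 0 ∷ F.# 4 ∷ [])) ∨ ((u == (F.# 0 ∷ F.# 5 ∷ [])) ∨ (b₂ ∧ (u == (F.# 1 ∷ F.# 0 ∷ [])))))))

  family : Bool → Bool → RelFamily 6
  family b₁ b₂ zero          = adjoinNonInj (collapse (E₁-class b₁))
  family b₁ b₂ (suc zero)    = adjoinNonInj (collapse (E₂-class b₂))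
  family b₁ b₂ (suc (suc k)) = adjoinNonInj _==_

  A : Bool → Bool → FinStr 6
  A b₁ b₂ = build 6 (family b₁ b₂)

  A-checkCPZ : ∀ b₁ b₂ → checkCPZ (A b₁ b₂) ≡ true
  A-checkCPZ b₁ b₂ = checkUpTo-build 6 (family b₁ b₂) isCPZ
    where
    isCPZ : ∀ k → k < 6 → IsCPZ (family b₁ b₂ k)
    isCPZ zero          _ = adjoinNonInj-isCPZ (collapse-isEquivalenceᵇ (E₁-class b₁))
    isCPZ (suc zero)    _ = adjoinNonInj-isCPZ (collapse-isEquivalenceᵇ (E₂-class b₂))
    isCPZ (suc (suc k)) _ = adjoinNonInj-isCPZ ==-isEquivalenceᵇ

  A-E₁ : ∀ b₁ b₂ → finRel (A b₁ b₂) 0 (F.# 0 ∷ []) (F.# 1 ∷ []) ≡ b₁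
  A-E₁ b₁ b₂ = trans (relUpTo-build 6 (family b₁ b₂) 0 (s≤s z≤n) (F.# 0 ∷ []) (F.# 1 ∷ [])) (E₁-bit b₁)
    where
    E₁-bit : ∀ b → family b b₂ 0 (F.# 0 ∷ []) (F.# 1 ∷ []) ≡ b
    E₁-bit true  = refl
    E₁-bit false = refl

  A-E₂ : ∀ b₁ b₂ → finRel (A b₁ b₂) 1 (F.# 0 ∷ F.# 1 ∷ []) (F.# 1 ∷ F.# 0 ∷ []) ≡ b₂
  A-E₂ b₁ b₂ = trans (relUpTo-build 6 (family b₁ b₂) 1 (s≤s (s≤s z≤n)) (F.# 0 ∷ F.# 1 ∷ []) (F.# 1 ∷ F.# 0 ∷ []))
                     (E₂-bit b₂)
    where
    E₂-bit : ∀ b → family b₁ b 1 (F.# 0 ∷ F.# 1 ∷ []) (F.# 1 ∷ F.# 0 ∷ []) ≡ b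
    E₂-bit true  = refl
    E₂-bit false = refl

  A-witnesses : ∀ b₁ b₂ → All (λ j → finRel (A b₁ b₂) 1 (F.# 0 ∷ F.# 1 ∷ []) (F.# 0 ∷ j ∷ []) ≡ true)
                              (F.# 2 L.∷ F.# 3 L.∷ F.# 4 L.∷ F.# 5 L.∷ L.[])
  A-witnesses b₁ b₂ = E₂-01 (F.# 2) refl All.∷ E₂-01 (F.# 3) refl All.∷ E₂-01 (F.# 4) refl All.∷
                      E₂-01 (F.# 5) refl All.∷ All.[]
    where
    E₂-01 : ∀ j → family b₁ b₂ 1 (F.# 0 ∷ F.# 1 ∷ []) (F.# 0 ∷ j ∷ []) ≡ true →
      finRel (A b₁ b₂) 1 (F.# 0 ∷ F.# 1 ∷ []) (F.# 0 ∷ j ∷ []) ≡ true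
    E₂-01 j = trans (relUpTo-build 6 (family b₁ b₂) 1 (s≤s (s≤s z≤n)) (F.# 0 ∷ F.# 1 ∷ []) (F.# 0 ∷ j ∷ []))

isYes⇔ : ∀ {P : Set} (d : Dec P) → (⌊ d ⌋ ≡ true) ⇔ P
isYes⇔ d = isYes-true⁻ d , isYes-true d

≡⇒≡true⇔ : ∀ {a b : Bool} → a ≡ b → (a ≡ true) ⇔ (b ≡ true)
≡⇒≡true⇔ a≡b = trans (sym a≡b) , trans a≡b

module Generic (M : Structure) (M-uh : Ultrahomogeneous M) (M-age : AgeInK M)
               {x y : Carrier M} (x≢y : x ≢ y) (b₁ b₂ : Bool)
               (b₁⇔ : (b₁ ≡ true) ⇔ PairType.E₁-bit M M-age (x ∷ y ∷ []))
               (b₂⇔ : (b₂ ≡ true) ⇔ PairType.E₂-bit M M-age (x ∷ y ∷ []))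
               (embedding : Embeds (SixPoints.A b₁ b₂) M) where
  open PairType M M-age
  open SixPoints using (A; A-E₁; A-E₂; A-witnesses)

  f : Fin 6 → Carrier M
  f = proj₁ embedding

  f-injective : ∀ i j → f i ≡ f j → i ≡ j
  f-injective = proj₁ (proj₂ embedding)

  f-E : ∀ k (t t' : Vec (Fin 6) (suc k)) → (finRel (A b₁ b₂) k t t' ≡ true) ⇔ E M k (V.map f t) (V.map f t')
  f-E = proj₂ (proj₂ embedding)

  c : Vec (Carrier M) 2
  c = f (F.# 0) ∷ f (F.# 1) ∷ []

  c-distinct : Distinct c
  c-distinct f₀≡f₁ = contradiction (f-injective (F.# 0) (F.# 1) f₀≡f₁) λ ()

  E₁-same : E₁-bit c ⇔ E₁-bit (x ∷ y ∷ [])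
  E₁-same = ⇔-trans (⇔-sym (f-E 0 (F.# 0 ∷ []) (F.# 1 ∷ []))) (⇔-trans (≡⇒≡true⇔ (A-E₁ b₁ b₂)) b₁⇔)

  E₂-same : E₂-bit c ⇔ E₂-bit (x ∷ y ∷ [])
  E₂-same = ⇔-trans (⇔-sym (f-E 1 (F.# 0 ∷ F.# 1 ∷ []) (F.# 1 ∷ F.# 0 ∷ []))) (⇔-trans (≡⇒≡true⇔ (A-E₂ b₁ b₂)) b₂⇔)

  extension : Σ (Carrier M → Carrier M) λ σ → Automorphism M σ × (∀ i → σ (lookup c i) ≡ lookup (x ∷ y ∷ []) i)
  extension = M-uh 2 c (x ∷ y ∷ []) (sameBits⇒PartialIso {c} {x ∷ y ∷ []} c-distinct x≢y E₁-same E₂-same)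

  σ : Carrier M → Carrier M
  σ = proj₁ extension

  σ-automorphism : Automorphism M σ
  σ-automorphism = proj₁ (proj₂ extension)

  σ-E : ∀ k (X Y : Vec (Carrier M) (suc k)) → E M k X Y ⇔ E M k (V.map σ X) (V.map σ Y)
  σ-E = proj₂ (proj₂ (proj₂ σ-automorphism))

  w : Fin 6 → Carrier M
  w j = σ (f j)

  w₀≡x : w (F.# 0) ≡ x
  w₀≡x = proj₂ (proj₂ extension) F.zero

  w₁≡y : w (F.# 1) ≡ y
  w₁≡y = proj₂ (proj₂ extension) (F.suc F.zero)

  w-injective : ∀ i j → w i ≡ w j → i ≡ j
  w-injective i j wᵢ≡wⱼ = f-injective i j (begin
    f i         ≡⟨ τσ (f i) ⟨
    τ (w i)     ≡⟨ cong τ wᵢ≡wⱼ ⟩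
    τ (w j)     ≡⟨ τσ (f j) ⟩
    f j         ∎)
    where
    open ≡-Reasoning
    τ = proj₁ σ-automorphism
    τσ = proj₁ (proj₂ σ-automorphism)

  w≢ : ∀ {i j} → i ≢ j → w i ≢ w j
  w≢ i≢j = i≢j ∘ w-injective _ _

  E₂[xy,xw] : ∀ j → finRel (A b₁ b₂) 1 (F.# 0 ∷ F.# 1 ∷ []) (F.# 0 ∷ j ∷ []) ≡ true → E M 1 (x ∷ y ∷ []) (x ∷ w j ∷ [])
  E₂[xy,xw] j e = subst₂ (λ u v → E M 1 (u ∷ v ∷ []) (u ∷ w j ∷ [])) w₀≡x w₁≡y
    (proj₁ (σ-E 1 (f (F.# 0) ∷ f (F.# 1) ∷ []) (f (F.# 0) ∷ f j ∷ [])) (proj₁ (f-E 1 (F.# 0 ∷ F.# 1 ∷ []) (F.# 0 ∷ j ∷ [])) e))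

  -- Atomic facts are double negated in Sat; contradiction a : ¬ ¬ A supplies them.
  matrix : Sat M (ands φ-matrix) (w (F.# 5) ∷ w (F.# 4) ∷ w (F.# 3) ∷ w (F.# 2) ∷ y ∷ x ∷ [])
  matrix = fromWitnesses (A-witnesses b₁ b₂)
    where
    ≢x : ∀ j → j ≢ F.# 0 → w j ≢ x
    ≢x j j≢0 = subst (w j ≢_) w₀≡x (w≢ j≢0)
    ≢y : ∀ j → j ≢ F.# 1 → w j ≢ y
    ≢y j j≢1 = subst (w j ≢_) w₁≡y (w≢ j≢1)
    fromWitnesses : All (λ j → finRel (A b₁ b₂) 1 (F.# 0 ∷ F.# 1 ∷ []) (F.# 0 ∷ j ∷ []) ≡ true)
                        (F.# 2 L.∷ F.# 3 L.∷ F.# 4 L.∷ F.# 5 L.∷ L.[]) →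
                    Sat M (ands φ-matrix) (w (F.# 5) ∷ w (F.# 4) ∷ w (F.# 3) ∷ w (F.# 2) ∷ y ∷ x ∷ [])
    fromWitnesses (e₂ All.∷ e₃ All.∷ e₄ All.∷ e₅ All.∷ All.[]) =
      contradiction (E₂[xy,xw] (F.# 2) e₂) , contradiction (E₂[xy,xw] (F.# 3) e₃) ,
      contradiction (E₂[xy,xw] (F.# 4) e₄) , contradiction (E₂[xy,xw] (F.# 5) e₅) ,
      contradiction (≢x (F.# 2) λ ()) , contradiction (≢y (F.# 2) λ ()) ,
      contradiction (≢x (F.# 3) λ ()) , contradiction (≢y (F.# 3) λ ()) ,
      contradiction (≢x (F.# 4) λ ()) , contradiction (≢y (F.# 4) λ ()) ,
      contradiction (≢x (F.# 5) λ ()) , contradiction (≢y (F.# 5) λ ()) ,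
      contradiction (w≢ {F.# 2} {F.# 3} λ ()) , contradiction (w≢ {F.# 2} {F.# 4} λ ()) ,
      contradiction (w≢ {F.# 2} {F.# 5} λ ()) , contradiction (w≢ {F.# 3} {F.# 4} λ ()) ,
      contradiction (w≢ {F.# 3} {F.# 5} λ ()) , contradiction (w≢ {F.# 4} {F.# 5} λ ()) , λ ()

φ∈TCPZ : InTCPZ φ
φ∈TCPZ M _ M-uh M-age M-K x y x≢y no-witnesses =
  ¬¬-excluded-middle λ d₁ → ¬¬-excluded-middle λ d₂ →
    let open Generic M M-uh M-age (x≢y ∘ contradiction) ⌊ d₁ ⌋ ⌊ d₂ ⌋ (isYes⇔ d₁) (isYes⇔ d₂)
               (M-K 6 (SixPoints.A ⌊ d₁ ⌋ ⌊ d₂ ⌋) (SixPoints.A-checkCPZ ⌊ d₁ ⌋ ⌊ d₂ ⌋)) in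
    no-witnesses (w (F.# 2) , contradiction (w (F.# 3) , contradiction (w (F.# 4) , contradiction (w (F.# 5) , matrix))))

proposition4p12 : Σ Sentence λ φ → InTCPZ φ × ((m : ℕ) → Σ ℕ λ N → (n : ℕ) → N ≤ n → countSat φ n * suc m < countK n)
proposition4p12 = φ , φ∈TCPZ , λ m → 3 + m , λ { (suc (suc n₀)) (s≤s (s≤s m<n₀)) → Encoding.countSat*suc<countK n₀ m m<n₀ }
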